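{- Let $p$ be a prime, let $n, D$ be nonnegative integers with $n\ge1$, and let $m, n_1,\dots,n_m$ be positive integers such that $n_1+\cdots+n_m\ge D$. Let $A_1,\dots,A_m\subseteq \mathbb{F}_p^n$ be sets such that for each $1\le i\le m$, $A_i$ is not contained in the zero set of any nonzero polynomial in $\mathbb{F}_p[X_1,\dots,X_n]$ of degree $\le n_i$. Then \[ |A_1+\cdots+A_m|\ge N(p,n,D). \]
   Context: $N(q,n,D)$ denotes the number of monomials $X_1^{\alpha_1}\cdots X_n^{\alpha_n}$ in $n$ variables of total degree $\alpha_1+\cdots+\alpha_n\le D$ with $\alpha_j\le q-1$ for every $j$. For sets $A_1,\dots,A_m$ in an abelian group, $A_1+\cdots+A_m=\{a_1+\cdots+a_m : a_i\in A_i\}$. -}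

module Defs where

open import Data.Nat using (ℕ; zero; suc; _+_; _*_; _∸_; _^_; _≤_; _≤?_; NonZero)
open import Data.Nat.DivMod using (_mod_; _%_)
open import Data.Nat.Primality using (Prime; prime⇒nonZero)
open import Data.Fin using (Fin; toℕ)
open import Data.Vec using (Vec; []; _∷_; zipWith; replicate; foldr)
open import Data.List using (List; []; _∷_; map; concatMap; upTo; length; filter; allFin)
open import Data.Product using (Σ; _×_; ∃)
open import Relation.Binary.PropositionalEquality using (_≡_)
open import Relation.Nullary using (¬_)
open import Data.List.Membership.Propositional using (_∈_)

Pt : ℕ → ℕ → Set
Pt p n = Vec (Fin p) n

addPt : ∀ {p n} → Prime p → Pt p n → Pt p n → Pt p n
addPt {p} pr = zipWith λ a b → let instance _ = prime⇒nonZero pr in (toℕ a + toℕ b) mod p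

zeroPt : ∀ {p n} → Prime p → Pt p n
zeroPt {p} {n} pr = let instance _ = prime⇒nonZero pr in replicate n (0 mod p)

sumPts : ∀ {p n} → Prime p → (m : ℕ) → (Fin m → Pt p n) → Pt p n
sumPts pr zero a = zeroPt pr
sumPts pr (suc m) a = addPt pr (a Fin.zero) (sumPts pr m (λ i → a (Fin.suc i)))

InSumset : ∀ {p n m} → Prime p → (Fin m → List (Pt p n)) → Pt p n → Set
InSumset {p} {n} {m} pr A x =
  Σ (Fin m → Pt p n) λ a → ((i : Fin m) → a i ∈ A i) × x ≡ sumPts pr m a

-- Exponent vectors (α_1,…,α_n) ∈ ℕ^n of total degree ≤ d, each listed once.
monos : (n d : ℕ) → List (Vec ℕ n)
monos zero d = [] ∷ []
monos (suc n) d = concatMap (λ a → map (a ∷_) (monos n (d ∸ a))) (upTo (suc d))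

-- A polynomial in F_p[X_1,…,X_n]: coefficient function on exponent vectors.
-- "of degree ≤ d" = only the coefficients of monomials in  monos n d  count.
Coeffs : ℕ → ℕ → Set
Coeffs p n = Vec ℕ n → Fin p

NonzeroPoly : ∀ {p} (n d : ℕ) → Coeffs p n → Set
NonzeroPoly n d c = ∃ λ α → α ∈ monos n d × ¬ (toℕ (c α) ≡ 0)

monomialℕ : ∀ {p n} → Pt p n → Vec ℕ n → ℕ
monomialℕ [] [] = 1
monomialℕ (x ∷ xs) (a ∷ as) = toℕ x ^ a * monomialℕ xs as

sumℕ : List ℕ → ℕ
sumℕ [] = 0
sumℕ (x ∷ xs) = x + sumℕ xs

Vanishes : ∀ {p n} → Prime p → (d : ℕ) → Coeffs p n → Pt p n → Set
Vanishes {p} {n} pr d c x = let instance _ = prime⇒nonZero pr in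
  sumℕ (map (λ α → toℕ (c α) * monomialℕ x α) (monos n d)) % p ≡ 0

allVecs : (q n : ℕ) → List (Vec (Fin q) n)
allVecs q zero = [] ∷ []
allVecs q (suc n) = concatMap (λ v → map (_∷ v) (allFin q)) (allVecs q n)

totalDeg : ∀ {q n} → Vec (Fin q) n → ℕ
totalDeg = foldr _ (λ a s → toℕ a + s) 0

-- N(q,n,D): number of monomials X^α with α_j ≤ q-1 and total degree ≤ D
N : (q n D : ℕ) → ℕ
N q n D = length (filter (λ α → totalDeg α ≤? D) (allVecs q n))

sumFin : (m : ℕ) → (Fin m → ℕ) → ℕ
sumFin zero f = 0
sumFin (suc m) f = f Fin.zero + sumFin m (λ i → f (Fin.suc i))

-- Call A ⊆ 𝔽ₚⁿ d-nondegenerate if no nonzero polynomial of degree ≤ d (with all exponents below p)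
-- vanishes on A. The monomials of degree ≤ d are then linearly independent as functions on A, so
-- |A| ≥ N(p,n,d). The hypothesis says that Aᵢ is nᵢ-nondegenerate, and nondegeneracy is additive:
-- if A is a-nondegenerate and B is b-nondegenerate, then A + B is (a + b)-nondegenerate. Indeed, let
-- c of degree ≤ a + b vanish on A + B, and split an exponent α of maximal degree in c as α = β + γ
-- with deg β ≤ a and deg γ ≤ b. Nondegeneracy of B provides weights ψ on B with
-- Σ_{y ∈ B} ψ_y y^ε = [ε = γ] whenever deg ε ≤ deg γ. The polynomial x ↦ Σ_{y ∈ B} ψ_y c(x + y)
-- vanishes on A, has degree ≤ a, and its coefficient of X^β is (α choose β) c_α ≠ 0, the binomial
-- coefficient being nonzero mod p because all exponents are below p.
module Submission where

open import Defs
open import Data.Nat using (ℕ; zero; suc; _+_; _*_; _∸_; _^_; _!; _⊓_; _⊔_; _%_; _≤_; _≥_; _<_; _≤?_; _<?_;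
  z≤n; s≤s; s≤s⁻¹; NonZero; >-nonZero⁻¹; nonTrivial⇒n>1; +-0-rawMonoid; *-1-rawMonoid)
open import Data.Nat.Properties
open import Data.Nat.DivMod using (_mod_; %-distribˡ-+; %-distribˡ-*; m%n%n≡m%n; [m+kn]%n≡m%n; m<n⇒m%n≡m)
open import Data.Nat.Divisibility using (_∣_; divides; m%n≡0⇒n∣m; n∣m⇒m%n≡0; ∣⇒≤; ∣-trans; m/n∣m)
open import Data.Nat.Combinatorics using (_C_; k>n⇒nCk≡0; nCk≡n!/k![n-k]!; k![n∸k]!∣n!)
open import Data.Nat.Primality using (Prime; prime⇒nonZero; prime⇒nonTrivial; prime⇒irreducible; euclidsLemma)
open import Data.Nat.Coprimality using (Coprime; coprime-Bézout)
open import Data.Nat.GCD using (module Bézout)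
open import Data.Nat.Tactic.RingSolver using (solve-∀)
open import Data.Fin using (Fin; zero; suc; toℕ; fromℕ<; punchIn; inject≤)
import Data.Fin as Fin
open import Data.Fin.Properties using (toℕ<n; toℕ-fromℕ<; fromℕ<-toℕ; toℕ-injective; punchInᵢ≢i; all?; ¬∀⟶∃¬; inject≤-injective)
open import Data.Vec using (Vec; []; _∷_; zipWith; replicate)
import Data.Vec as Vec
open import Data.Vec.Properties using (∷-injective; ≡-dec)
open import Data.Vec.Relation.Binary.Pointwise.Inductive as Pointwise using (Pointwise; []; _∷_)
import Data.Vec.Functional as Vector
open import Data.Vec.Functional using (insertAt)
open import Data.Vec.Functional.Properties using (insertAt-lookup; insertAt-punchIn)
open import Data.Maybe using (Maybe; just; nothing; maybe)
open import Data.List using (List; []; _∷_; _++_; map; concatMap; length; lookup; tabulate; applyUpTo; upTo;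
  allFin; filter; deduplicate)
open import Data.List.Membership.Propositional using (_∈_; find)
open import Data.List.Membership.Propositional.Properties using (∈-map⁺; ∈-map⁻; ∈-allFin; ∈-concatMap⁺; ∈-concatMap⁻;
  ∈-filter⁺; ∈-filter⁻; ∈-lookup; ∈-upTo⁺; ∈-deduplicate⁺; ∈-deduplicate⁻)
open import Data.List.Relation.Unary.Any using (here; there)
import Data.List.Relation.Unary.Any as Any
open import Data.List.Relation.Unary.Any.Properties using (lookup-index)
open import Data.List.Relation.Unary.All using ([])
import Data.List.Relation.Unary.All as All
open import Data.List.Relation.Unary.All.Properties using (all-filter)
open import Data.List.Relation.Unary.AllPairs using ([]; _∷_)
open import Data.List.Relation.Unary.Unique.Propositional using (Unique)
import Data.List.Relation.Unary.Unique.Propositional.Properties as Unique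
open import Data.List.Relation.Unary.Unique.DecPropositional.Properties using (deduplicate-!)
open import Data.List.Extrema.Nat using (argmax; argmax-all; f[xs]≤f[argmax])
open import Data.Product using (Σ; _×_; _,_; proj₁; proj₂)
open import Data.Sum using (_⊎_; inj₁; inj₂)
import Data.Sum as Sum
open import Data.Empty using (⊥; ⊥-elim)
open import Relation.Nullary using (¬_; Dec; yes; no; ¬?)
open import Relation.Binary.PropositionalEquality
open import Relation.Binary.Definitions using (DecidableEquality)
open import Relation.Binary.Bundles using (Setoid)
import Relation.Binary.Reasoning.Setoid as SetoidReasoning
open import Function using (_∘_)
open import Function.Definitions using (Injective)
import Algebra.Properties.CommutativeSemiring.Binomial +-*-commutativeSemiring as Binomial
open import Algebra.Properties.CommutativeSemigroup +-commutativeSemigroup using (interchange; x∙yz≈y∙xz)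
import Algebra.Definitions.RawMonoid as RawMonoid

-- Finite sums

sumMap : {A : Set} → List A → (A → ℕ) → ℕ
sumMap xs f = sumℕ (map f xs)

module _ {A : Set} (_≟_ : DecidableEquality A) where

  kronecker : A → A → ℕ
  kronecker a b with a ≟ b
  ... | yes _ = 1
  ... | no  _ = 0

  kronecker-refl : ∀ a → kronecker a a ≡ 1
  kronecker-refl a with a ≟ a
  ... | yes _   = refl
  ... | no  a≢a = ⊥-elim (a≢a refl)

  kronecker-≢ : ∀ {a b} → a ≢ b → kronecker a b ≡ 0
  kronecker-≢ {a} {b} a≢b with a ≟ b
  ... | yes a≡b = ⊥-elim (a≢b a≡b)
  ... | no  _   = refl

sumFin-cong : ∀ k {f g : Fin k → ℕ} → (∀ i → f i ≡ g i) → sumFin k f ≡ sumFin k g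
sumFin-cong zero    e = refl
sumFin-cong (suc k) e = cong₂ _+_ (e zero) (sumFin-cong k (e ∘ suc))

sumFin-zero : ∀ k {f : Fin k → ℕ} → (∀ i → f i ≡ 0) → sumFin k f ≡ 0
sumFin-zero zero    e = refl
sumFin-zero (suc k) e = cong₂ _+_ (e zero) (sumFin-zero k (e ∘ suc))

sumFin-+ : ∀ k (f g : Fin k → ℕ) → sumFin k (λ i → f i + g i) ≡ sumFin k f + sumFin k g
sumFin-+ zero    f g = refl
sumFin-+ (suc k) f g = trans (cong (f zero + g zero +_) (sumFin-+ k (f ∘ suc) (g ∘ suc)))
  (interchange (f zero) (g zero) _ _)

sumFin-*ˡ : ∀ k c (f : Fin k → ℕ) → c * sumFin k f ≡ sumFin k (λ i → c * f i)
sumFin-*ˡ zero    c f = *-zeroʳ c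
sumFin-*ˡ (suc k) c f = trans (*-distribˡ-+ c (f zero) _) (cong (c * f zero +_) (sumFin-*ˡ k c (f ∘ suc)))

sumFin-*ʳ : ∀ k c (f : Fin k → ℕ) → sumFin k f * c ≡ sumFin k (λ i → f i * c)
sumFin-*ʳ k c f = trans (*-comm _ c) (trans (sumFin-*ˡ k c f) (sumFin-cong k (λ i → *-comm c (f i))))

sumFin-swap : ∀ k l (f : Fin k → Fin l → ℕ) →
  sumFin k (λ i → sumFin l (f i)) ≡ sumFin l (λ j → sumFin k (λ i → f i j))
sumFin-swap zero    l f = sym (sumFin-zero l (λ _ → refl))
sumFin-swap (suc k) l f = trans (cong (sumFin l (f zero) +_) (sumFin-swap k l (f ∘ suc)))
  (sym (sumFin-+ l (f zero) _))

sumFin-punchIn : ∀ k (f : Fin (suc k) → ℕ) i → sumFin (suc k) f ≡ f i + sumFin k (f ∘ punchIn i)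
sumFin-punchIn k       f zero    = refl
sumFin-punchIn (suc k) f (suc i) = trans (cong (f zero +_) (sumFin-punchIn k (f ∘ suc) i))
  (x∙yz≈y∙xz (f zero) (f (suc i)) _)

sumFin-extend : ∀ k j (f : ℕ → ℕ) → (∀ a → k ≤ a → f a ≡ 0) →
  sumFin (k + j) (f ∘ toℕ) ≡ sumFin k (f ∘ toℕ)
sumFin-extend zero    j f z = sumFin-zero j (λ i → z (toℕ i) z≤n)
sumFin-extend (suc k) j f z = cong (f 0 +_) (sumFin-extend k j (f ∘ suc) (λ a k≤a → z (suc a) (s≤s k≤a)))

sumFin-stable : ∀ k₁ k₂ {f : ℕ → ℕ} → (∀ a → k₁ ≤ a → f a ≡ 0) → (∀ a → k₂ ≤ a → f a ≡ 0) →
  sumFin k₁ (f ∘ toℕ) ≡ sumFin k₂ (f ∘ toℕ)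
sumFin-stable k₁ k₂ {f} vanish₁ vanish₂ = begin
  sumFin k₁ (f ∘ toℕ)          ≡⟨ sumFin-extend k₁ k₂ f vanish₁ ⟨
  sumFin (k₁ + k₂) (f ∘ toℕ)   ≡⟨ cong (λ k → sumFin k (f ∘ toℕ)) (+-comm k₁ k₂) ⟩
  sumFin (k₂ + k₁) (f ∘ toℕ)   ≡⟨ sumFin-extend k₂ k₁ f vanish₂ ⟩
  sumFin k₂ (f ∘ toℕ)          ∎
  where open ≡-Reasoning

dot : ∀ k → (Fin k → ℕ) → (Fin k → ℕ) → ℕ
dot k u v = sumFin k (λ i → u i * v i)

module _ {A : Set} where

  sumMap-cong : ∀ (xs : List A) {f g : A → ℕ} → (∀ x → f x ≡ g x) → sumMap xs f ≡ sumMap xs g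
  sumMap-cong []       e = refl
  sumMap-cong (x ∷ xs) e = cong₂ _+_ (e x) (sumMap-cong xs e)

  sumMap-+ : ∀ (xs : List A) (f g : A → ℕ) → sumMap xs (λ x → f x + g x) ≡ sumMap xs f + sumMap xs g
  sumMap-+ []       f g = refl
  sumMap-+ (x ∷ xs) f g = trans (cong (f x + g x +_) (sumMap-+ xs f g)) (interchange (f x) (g x) _ _)

  sumMap-*ˡ : ∀ (xs : List A) c (f : A → ℕ) → c * sumMap xs f ≡ sumMap xs (λ x → c * f x)
  sumMap-*ˡ []       c f = *-zeroʳ c
  sumMap-*ˡ (x ∷ xs) c f = trans (*-distribˡ-+ c (f x) _) (cong (c * f x +_) (sumMap-*ˡ xs c f))

  sumMap-*ʳ : ∀ (xs : List A) c (f : A → ℕ) → sumMap xs f * c ≡ sumMap xs (λ x → f x * c)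
  sumMap-*ʳ xs c f = trans (*-comm _ c) (trans (sumMap-*ˡ xs c f) (sumMap-cong xs (λ x → *-comm c (f x))))

  sumMap-++ : ∀ (xs ys : List A) f → sumMap (xs ++ ys) f ≡ sumMap xs f + sumMap ys f
  sumMap-++ []       ys f = refl
  sumMap-++ (x ∷ xs) ys f = trans (cong (f x +_) (sumMap-++ xs ys f)) (sym (+-assoc (f x) _ _))

  sumMap-lookup : ∀ (xs : List A) f → sumMap xs f ≡ sumFin (length xs) (f ∘ lookup xs)
  sumMap-lookup []       f = refl
  sumMap-lookup (x ∷ xs) f = cong (f x +_) (sumMap-lookup xs f)

  sumMap-sumFin : ∀ (xs : List A) k (f : A → Fin k → ℕ) →
    sumMap xs (λ x → sumFin k (f x)) ≡ sumFin k (λ j → sumMap xs (λ x → f x j))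
  sumMap-sumFin xs k f = trans (sumMap-lookup xs _)
    (trans (sumFin-swap (length xs) k (f ∘ lookup xs))
      (sumFin-cong k (λ j → sym (sumMap-lookup xs (λ x → f x j)))))

sumMap-tabulate : ∀ {A : Set} k (g : Fin k → A) f → sumMap (tabulate g) f ≡ sumFin k (f ∘ g)
sumMap-tabulate zero    g f = refl
sumMap-tabulate (suc k) g f = cong (f (g zero) +_) (sumMap-tabulate k (g ∘ suc) f)

sumMap-applyUpTo : ∀ {A : Set} (g : ℕ → A) k f → sumMap (applyUpTo g k) f ≡ sumFin k (f ∘ g ∘ toℕ)
sumMap-applyUpTo g zero    f = refl
sumMap-applyUpTo g (suc k) f = cong (f (g 0) +_) (sumMap-applyUpTo (g ∘ suc) k f)

module _ {A B : Set} where

  sumMap-map : ∀ (h : A → B) (xs : List A) f → sumMap (map h xs) f ≡ sumMap xs (f ∘ h)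
  sumMap-map h []       f = refl
  sumMap-map h (x ∷ xs) f = cong (f (h x) +_) (sumMap-map h xs f)

  sumMap-concatMap : ∀ (g : A → List B) (xs : List A) f →
    sumMap (concatMap g xs) f ≡ sumMap xs (λ x → sumMap (g x) f)
  sumMap-concatMap g []       f = refl
  sumMap-concatMap g (x ∷ xs) f =
    trans (sumMap-++ (g x) (concatMap g xs) f) (cong (sumMap (g x) f +_) (sumMap-concatMap g xs f))

  sumMap-swap : ∀ (xs : List A) (ys : List B) (f : A → B → ℕ) →
    sumMap xs (λ x → sumMap ys (f x)) ≡ sumMap ys (λ y → sumMap xs (λ x → f x y))
  sumMap-swap xs ys f = trans (sumMap-lookup xs _)
    (trans (sym (sumMap-sumFin ys (length xs) (λ y i → f (lookup xs i) y)))
      (sumMap-cong ys (λ y → sym (sumMap-lookup xs (λ x → f x y)))))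

module _ {A : Set} where

  lookup-injective : ∀ {xs : List A} → Unique xs → ∀ i j → lookup xs i ≡ lookup xs j → i ≡ j
  lookup-injective {_ ∷ _}  _            zero    zero    _ = refl
  lookup-injective {_ ∷ xs} (x∉xs ∷ _)   zero    (suc j) e = ⊥-elim (All.lookup x∉xs (∈-lookup j) e)
  lookup-injective {_ ∷ xs} (x∉xs ∷ _)   (suc i) zero    e = ⊥-elim (All.lookup x∉xs (∈-lookup i) (sym e))
  lookup-injective {_ ∷ _}  (_ ∷ unique) (suc i) (suc j) e = cong suc (lookup-injective unique i j e)

  Unique-concatMap : ∀ {B : Set} (f : B → List A) {ys} → Unique ys → (∀ y → Unique (f y)) →
    (∀ {y y′ x} → x ∈ f y → x ∈ f y′ → y ≡ y′) → Unique (concatMap f ys)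
  Unique-concatMap f {[]}     []            _        _    = []
  Unique-concatMap f {y ∷ ys} (y∉ys ∷ uniq) uniqueF disjoint =
    Unique.++⁺ (uniqueF y) (Unique-concatMap f uniq uniqueF disjoint) separate
    where
    separate : ∀ {x} → x ∈ f y × x ∈ concatMap f ys → ⊥
    separate (x∈fy , x∈rest) with find (∈-concatMap⁻ f x∈rest)
    ... | z , z∈ys , x∈fz = All.lookup y∉ys z∈ys (disjoint x∈fy x∈fz)

∈-concatMap : ∀ {A B : Set} (f : A → List B) {x y ys} → x ∈ f y → y ∈ ys → x ∈ concatMap f ys
∈-concatMap f x∈fy y∈ys = ∈-concatMap⁺ f (Any.map (λ { refl → x∈fy }) y∈ys)

indicator : ∀ {P : Set} → Dec P → ℕ
indicator (yes _) = 1
indicator (no  _) = 0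

indicator-cong : ∀ {P Q : Set} → (P → Q) → (Q → P) → (P? : Dec P) (Q? : Dec Q) → indicator P? ≡ indicator Q?
indicator-cong P→Q Q→P (yes _) (yes _) = refl
indicator-cong P→Q Q→P (yes P) (no ¬Q) = ⊥-elim (¬Q (P→Q P))
indicator-cong P→Q Q→P (no ¬P) (yes Q) = ⊥-elim (¬P (Q→P Q))
indicator-cong P→Q Q→P (no _)  (no _)  = refl

indicator-no : ∀ {P : Set} (P? : Dec P) → ¬ P → indicator P? ≡ 0
indicator-no (yes P) ¬P = ⊥-elim (¬P P)
indicator-no (no  _) ¬P = refl

-- Binomial coefficients

private
  ×≡* : ∀ n x → RawMonoid._×_ +-0-rawMonoid n x ≡ n * x
  ×≡* zero    x = refl
  ×≡* (suc n) x = cong (x +_) (×≡* n x)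

  ^≡^ : ∀ x n → RawMonoid._×_ *-1-rawMonoid n x ≡ x ^ n
  ^≡^ x zero    = refl
  ^≡^ x (suc n) = cong (x *_) (^≡^ x n)

  foldr≡sumFin : ∀ k (f : Fin k → ℕ) → Vector.foldr _+_ 0 f ≡ sumFin k f
  foldr≡sumFin zero    f = refl
  foldr≡sumFin (suc k) f = cong (f zero +_) (foldr≡sumFin k (f ∘ suc))

binomialTerm : ℕ → ℕ → ℕ → ℕ → ℕ
binomialTerm a u v t = (a C t) * (u ^ t * v ^ (a ∸ t))

-- The standard library's binomial theorem, transported from the generic semiring operations to those of ℕ.
binomial-theorem : ∀ a u v → (u + v) ^ a ≡ sumFin (suc a) (binomialTerm a u v ∘ toℕ)
binomial-theorem a u v =
  trans (sym (^≡^ (u + v) a)) (trans (Binomial.theorem a u v) (trans (foldr≡sumFin (suc a) (Binomial.binomialTerm u v a))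
    (sumFin-cong (suc a) λ t → trans (×≡* (a C toℕ t) _) (cong ((a C toℕ t) *_) (cong₂ _*_ (^≡^ u (toℕ t)) (^≡^ v (a ∸ toℕ t)))))))

binomial-expansion : ∀ {a} k → a < k → ∀ u v → (u + v) ^ a ≡ sumFin k (binomialTerm a u v ∘ toℕ)
binomial-expansion {a} k a<k u v = begin
  (u + v) ^ a                                ≡⟨ binomial-theorem a u v ⟩
  sumFin (suc a) (binomialTerm a u v ∘ toℕ)  ≡⟨ sumFin-stable (suc a) k vanish (λ t k≤t → vanish t (≤-trans a<k k≤t)) ⟩
  sumFin k (binomialTerm a u v ∘ toℕ)        ∎
  where
  open ≡-Reasoning
  vanish : ∀ t → suc a ≤ t → binomialTerm a u v t ≡ 0
  vanish t a<t = cong (_* (u ^ t * v ^ (a ∸ t))) (k>n⇒nCk≡0 a<t)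

nCk∣n! : ∀ {n k} → k ≤ n → n C k ∣ n !
nCk∣n! {n} {k} k≤n = subst (_∣ n !) (sym (nCk≡n!/k![n-k]! k≤n)) (m/n∣m (k![n∸k]!∣n! k≤n))
  where instance _ = k !* (n ∸ k) !≢0

-- Residues modulo p are represented by natural numbers; _≈_ is equality of residues.
module Congruence (p : ℕ) .{{_ : NonZero p}} where

  infix 4 _≈_ _≉_
  _≈_ : ℕ → ℕ → Set
  a ≈ b = a % p ≡ b % p

  _≉_ : ℕ → ℕ → Set
  a ≉ b = ¬ a ≈ b

  _≈?_ : (a b : ℕ) → Dec (a ≈ b)
  a ≈? b = a % p Data.Nat.≟ b % p

  ≈-setoid : Setoid _ _
  ≈-setoid = record { Carrier = ℕ ; _≈_ = _≈_ ; isEquivalence = record { refl = refl ; sym = sym ; trans = trans } }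

  module ≈-Reasoning = SetoidReasoning ≈-setoid

  ≡⇒≈ : ∀ {a b} → a ≡ b → a ≈ b
  ≡⇒≈ = cong (_% p)

  %-≈ : ∀ a → a % p ≈ a
  %-≈ a = m%n%n≡m%n a p

  +-≈ : ∀ {a b c d} → a ≈ b → c ≈ d → a + c ≈ b + d
  +-≈ {a} {b} {c} {d} a≈b c≈d = begin
    (a + c) % p           ≡⟨ %-distribˡ-+ a c p ⟩
    (a % p + c % p) % p   ≡⟨ cong₂ (λ u v → (u + v) % p) a≈b c≈d ⟩
    (b % p + d % p) % p   ≡⟨ %-distribˡ-+ b d p ⟨
    (b + d) % p           ∎
    where open ≡-Reasoning

  *-≈ : ∀ {a b c d} → a ≈ b → c ≈ d → a * c ≈ b * d
  *-≈ {a} {b} {c} {d} a≈b c≈d = begin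
    (a * c) % p               ≡⟨ %-distribˡ-* a c p ⟩
    (a % p * (c % p)) % p     ≡⟨ cong₂ (λ u v → (u * v) % p) a≈b c≈d ⟩
    (b % p * (d % p)) % p     ≡⟨ %-distribˡ-* b d p ⟨
    (b * d) % p               ∎
    where open ≡-Reasoning

  ^-≈ : ∀ {a b} k → a ≈ b → a ^ k ≈ b ^ k
  ^-≈ zero    _   = refl
  ^-≈ (suc k) a≈b = *-≈ a≈b (^-≈ k a≈b)

  +-≈ˡ : ∀ a {c d} → c ≈ d → a + c ≈ a + d
  +-≈ˡ a = +-≈ {a} refl

  *-≈ˡ : ∀ a {c d} → c ≈ d → a * c ≈ a * d
  *-≈ˡ a = *-≈ {a} refl

  *-≈ʳ : ∀ {a b} c → a ≈ b → a * c ≈ b * c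
  *-≈ʳ {a} {b} c a≈b = *-≈ {a} {b} {c} a≈b refl

  0%p≡0 : 0 % p ≡ 0
  0%p≡0 = m<n⇒m%n≡m (>-nonZero⁻¹ p)

  ≈0⇒∣ : ∀ {a} → a ≈ 0 → p ∣ a
  ≈0⇒∣ {a} a≈0 = m%n≡0⇒n∣m a p (trans a≈0 0%p≡0)

  ∣⇒≈0 : ∀ {a} → p ∣ a → a ≈ 0
  ∣⇒≈0 {a} p∣a = trans (n∣m⇒m%n≡0 a p p∣a) (sym 0%p≡0)

  *-zeroʳ-≈ : ∀ a {b} → b ≈ 0 → a * b ≈ 0
  *-zeroʳ-≈ a {b} b≈0 = trans (*-≈ˡ a b≈0) (≡⇒≈ (*-zeroʳ a))

  *-zeroˡ-≈ : ∀ {a} b → a ≈ 0 → a * b ≈ 0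
  *-zeroˡ-≈ {a} b a≈0 = *-≈ʳ {a} {0} b a≈0

  +-identityʳ-≈ : ∀ a {b} → b ≈ 0 → a + b ≈ a
  +-identityʳ-≈ a b≈0 = trans (+-≈ˡ a b≈0) (≡⇒≈ (+-identityʳ a))

  sumFin-≈ : ∀ k {f g : Fin k → ℕ} → (∀ i → f i ≈ g i) → sumFin k f ≈ sumFin k g
  sumFin-≈ zero    e = refl
  sumFin-≈ (suc k) e = +-≈ (e zero) (sumFin-≈ k (e ∘ suc))

  sumFin-≈0 : ∀ k {f : Fin k → ℕ} → (∀ i → f i ≈ 0) → sumFin k f ≈ 0
  sumFin-≈0 zero    e = refl
  sumFin-≈0 (suc k) e = +-≈ (e zero) (sumFin-≈0 k (e ∘ suc))

  sumFin-single : ∀ k (f : Fin k → ℕ) i → (∀ j → j ≢ i → f j ≈ 0) → sumFin k f ≈ f i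
  sumFin-single (suc k) f i others≈0 = trans (≡⇒≈ (sumFin-punchIn k f i))
    (+-identityʳ-≈ (f i) (sumFin-≈0 k (λ j → others≈0 (punchIn i j) (punchInᵢ≢i i j))))

  module _ {A : Set} where

    sumMap-≈ : ∀ (xs : List A) {f g : A → ℕ} → (∀ x → x ∈ xs → f x ≈ g x) → sumMap xs f ≈ sumMap xs g
    sumMap-≈ []       e = refl
    sumMap-≈ (x ∷ xs) e = +-≈ (e x (here refl)) (sumMap-≈ xs (λ y y∈ → e y (there y∈)))

    sumMap-≈0 : ∀ (xs : List A) {f : A → ℕ} → (∀ x → x ∈ xs → f x ≈ 0) → sumMap xs f ≈ 0
    sumMap-≈0 xs e = trans (sumMap-≈ xs e) (≡⇒≈ (sumMap-zero xs))
      where sumMap-zero : ∀ (ys : List A) → sumMap ys (λ _ → 0) ≡ 0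
            sumMap-zero []       = refl
            sumMap-zero (_ ∷ ys) = sumMap-zero ys

    sumMap-single : ∀ {xs : List A} (f : A → ℕ) {w} → Unique xs → w ∈ xs → (∀ x → x ≢ w → f x ≈ 0) →
      sumMap xs f ≈ f w
    sumMap-single {x ∷ xs} f (x∉xs ∷ _) (here refl) others≈0 =
      +-identityʳ-≈ (f x) (sumMap-≈0 xs λ y y∈xs → others≈0 y (≢-sym (All.lookup x∉xs y∈xs)))
    sumMap-single {x ∷ xs} f (x∉xs ∷ uniq) (there w∈) others≈0 =
      trans (+-≈ {f x} {0} (others≈0 x (All.lookup x∉xs w∈)) (sumMap-single f uniq w∈ others≈0)) refl

module PrimeField (p : ℕ) (pr : Prime p) where

  instance
    p≢0 : NonZero p
    p≢0 = prime⇒nonZero pr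

  open Congruence p public

  1≉0 : 1 ≉ 0
  1≉0 1≈0 with trans (sym (m<n⇒m%n≡m (nonTrivial⇒n>1 p {{prime⇒nonTrivial pr}}))) (trans 1≈0 0%p≡0)
  ... | ()

  *-≉0 : ∀ {a b} → a ≉ 0 → b ≉ 0 → a * b ≉ 0
  *-≉0 {a} {b} a≉0 b≉0 ab≈0 with euclidsLemma a b pr (≈0⇒∣ ab≈0)
  ... | inj₁ p∣a = a≉0 (∣⇒≈0 p∣a)
  ... | inj₂ p∣b = b≉0 (∣⇒≈0 p∣b)

  neg : ℕ → ℕ
  neg a = (p ∸ 1) * a

  +-inverseʳ : ∀ a → a + neg a ≈ 0
  +-inverseʳ a = ∣⇒≈0 (divides a (begin
    a + (p ∸ 1) * a     ≡⟨ cong (_+ (p ∸ 1) * a) (*-identityˡ a) ⟨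
    1 * a + (p ∸ 1) * a ≡⟨ *-distribʳ-+ a 1 (p ∸ 1) ⟨
    (1 + (p ∸ 1)) * a   ≡⟨ cong (_* a) (m+[n∸m]≡n (>-nonZero⁻¹ p)) ⟩
    p * a               ≡⟨ *-comm p a ⟩
    a * p               ∎))
    where open ≡-Reasoning

  +-inverseˡ : ∀ a → neg a + a ≈ 0
  +-inverseˡ a = trans (≡⇒≈ (+-comm (neg a) a)) (+-inverseʳ a)

  +-neg-cancel : ∀ x y → x + neg y + y ≈ x
  +-neg-cancel x y = trans (≡⇒≈ (+-assoc x (neg y) y)) (+-identityʳ-≈ x (+-inverseˡ y))

  *-neg-cancel : ∀ x k y → x + neg k * y + k * y ≈ x
  *-neg-cancel x k y = trans (≡⇒≈ (cong (λ z → x + z + k * y) (*-assoc (p ∸ 1) k y))) (+-neg-cancel x (k * y))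

  private
    coprime : ∀ {a} → a ≉ 0 → Coprime a p
    coprime a≉0 (d∣a , d∣p) with prime⇒irreducible pr d∣p
    ... | inj₁ d≡1 = d≡1
    ... | inj₂ refl = ⊥-elim (a≉0 (∣⇒≈0 d∣a))

  inv : ∀ a → a ≉ 0 → ℕ
  inv a a≉0 with coprime-Bézout (coprime a≉0)
  ... | Bézout.+- x _ _ = x
  ... | Bézout.-+ x _ _ = neg x

  *-inverseʳ : ∀ a (a≉0 : a ≉ 0) → a * inv a a≉0 ≈ 1
  *-inverseʳ a a≉0 with coprime-Bézout (coprime a≉0)
  ... | Bézout.+- x y 1+yp≡xa = begin
    (a * x) % p     ≡⟨ cong (_% p) (trans (*-comm a x) (sym 1+yp≡xa)) ⟩
    (1 + y * p) % p ≡⟨ [m+kn]%n≡m%n 1 y p ⟩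
    1 % p           ∎
    where open ≡-Reasoning
  ... | Bézout.-+ x y 1+xa≡yp = begin
    a * neg x                 ≡⟨ a[qx]≡q[xa] a x (p ∸ 1) ⟩
    neg (x * a)               ≈⟨ +-identityʳ-≈ (neg (x * a)) (∣⇒≈0 (divides y 1+xa≡yp)) ⟨
    neg (x * a) + (1 + x * a) ≡⟨ +-comm (neg (x * a)) (1 + x * a) ⟩
    1 + x * a + neg (x * a)   ≡⟨ +-assoc 1 (x * a) (neg (x * a)) ⟩
    1 + (x * a + neg (x * a)) ≈⟨ +-identityʳ-≈ 1 (+-inverseʳ (x * a)) ⟩
    1                         ∎
    where open ≈-Reasoning
          a[qx]≡q[xa] : ∀ a x q → a * (q * x) ≡ q * (x * a)
          a[qx]≡q[xa] = solve-∀

  p∤n! : ∀ n → n < p → ¬ p ∣ n !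
  p∤n! zero    _   p∣1  = 1≉0 (∣⇒≈0 p∣1)
  p∤n! (suc n) n<p p∣n! with euclidsLemma (suc n) (n !) pr p∣n!
  ... | inj₁ p∣1+n = <⇒≱ n<p (∣⇒≤ p∣1+n)
  ... | inj₂ p∣n!′ = p∤n! n (<-trans (n<1+n n) n<p) p∣n!′

  nCk≉0 : ∀ {n k} → n < p → k ≤ n → n C k ≉ 0
  nCk≉0 {n} n<p k≤n nCk≈0 = p∤n! n n<p (∣-trans (≈0⇒∣ nCk≈0) (nCk∣n! k≤n))

module LinearAlgebra (p : ℕ) (pr : Prime p) where

  open PrimeField p pr

  column : ∀ {k s} → (Fin k → Fin s → ℕ) → Fin s → Fin k → ℕ
  column M j i = M i j

  find-nonzero : ∀ s (g : Fin s → ℕ) → (Σ (Fin s) λ j → g j ≉ 0) ⊎ (∀ j → g j ≈ 0)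
  find-nonzero s g with all? (λ j → g j ≈? 0)
  ... | yes all≈0 = inj₂ all≈0
  ... | no ¬all≈0 = inj₁ (¬∀⟶∃¬ s (λ j → g j ≈ 0) (λ j → g j ≈? 0) ¬all≈0)

  -- eliminate subtracts multiples of row i₀ from the other rows so as to clear column c,
  -- and lift is the transpose of this row operation (dot-lift).
  module Elimination {k s} (M : Fin (suc k) → Fin s → ℕ) (i₀ : Fin (suc k)) (c : Fin s)
                     (pivot≉0 : M i₀ c ≉ 0) where

    κ : Fin k → ℕ
    κ r = M (punchIn i₀ r) c * inv (M i₀ c) pivot≉0

    eliminate : (Fin (suc k) → ℕ) → Fin k → ℕ
    eliminate v r = v (punchIn i₀ r) + neg (κ r) * v i₀

    eliminate-pivot : ∀ r → eliminate (column M c) r ≈ 0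
    eliminate-pivot r = trans (+-≈ˡ x neg[κ]a≈neg[x]) (+-inverseʳ x)
      where
      x a : ℕ
      x = M (punchIn i₀ r) c
      a = M i₀ c
      q[xy]z≡qx[zy] : ∀ q x y z → q * (x * y) * z ≡ q * x * (z * y)
      q[xy]z≡qx[zy] = solve-∀
      neg[κ]a≈neg[x] : neg (κ r) * a ≈ neg x
      neg[κ]a≈neg[x] = begin
        neg (κ r) * a             ≡⟨ q[xy]z≡qx[zy] (p ∸ 1) x (inv a pivot≉0) a ⟩
        neg x * (a * inv a pivot≉0) ≈⟨ *-≈ˡ (neg x) (*-inverseʳ a pivot≉0) ⟩
        neg x * 1                 ≡⟨ *-identityʳ (neg x) ⟩
        neg x                     ∎
        where open ≈-Reasoning

    eliminate-restore : ∀ v r → eliminate v r + κ r * v i₀ ≈ v (punchIn i₀ r)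
    eliminate-restore v r = *-neg-cancel (v (punchIn i₀ r)) (κ r) (v i₀)

    lift : (Fin k → ℕ) → Fin (suc k) → ℕ
    lift l = insertAt l i₀ (dot k l (neg ∘ κ))

    dot-lift : ∀ l v → dot (suc k) (lift l) v ≡ dot k l (eliminate v)
    dot-lift l v = begin
      dot (suc k) (lift l) v
        ≡⟨ sumFin-punchIn k (λ i → lift l i * v i) i₀ ⟩
      lift l i₀ * v i₀ + dot k (lift l ∘ punchIn i₀) (v ∘ punchIn i₀)
        ≡⟨ cong₂ _+_ (cong (_* v i₀) (insertAt-lookup l i₀ _))
                     (sumFin-cong k (λ r → cong (_* v (punchIn i₀ r)) (insertAt-punchIn l i₀ _ r))) ⟩
      dot k l (neg ∘ κ) * v i₀ + dot k l (v ∘ punchIn i₀)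
        ≡⟨ cong (_+ _) (sumFin-*ʳ k (v i₀) _) ⟩
      sumFin k (λ r → l r * neg (κ r) * v i₀) + dot k l (v ∘ punchIn i₀)
        ≡⟨ sumFin-+ k _ _ ⟨
      sumFin k (λ r → l r * neg (κ r) * v i₀ + l r * v (punchIn i₀ r))
        ≡⟨ sumFin-cong k (λ r → ab[c]+ad≡a[d+bc] (l r) (neg (κ r)) (v i₀) (v (punchIn i₀ r))) ⟩
      dot k l (eliminate v) ∎
      where
      open ≡-Reasoning
      ab[c]+ad≡a[d+bc] : ∀ a b c d → a * b * c + a * d ≡ a * (d + b * c)
      ab[c]+ad≡a[d+bc] = solve-∀

    lift-kills-pivot : ∀ l → dot (suc k) (lift l) (column M c) ≈ 0
    lift-kills-pivot l = trans (≡⇒≈ (dot-lift l (column M c)))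
      (sumFin-≈0 k (λ r → *-zeroʳ-≈ (l r) (eliminate-pivot r)))

  Solution : ∀ {k s} → (Fin k → Fin s → ℕ) → (Fin k → ℕ) → Set
  Solution {k} {s} M t = Σ (Fin s → ℕ) λ ψ → ∀ r → dot s (M r) ψ ≈ t r

  Obstruction : ∀ {k s} → (Fin k → Fin s → ℕ) → (Fin k → ℕ) → Set
  Obstruction {k} {s} M t = Σ (Fin k → ℕ) λ l → (∀ j → dot k l (column M j) ≈ 0) × dot k l t ≉ 0

  module _ {k s} (M : Fin (suc k) → Fin s → ℕ) (c : Fin s) (pivot≉0 : M zero c ≉ 0) (t : Fin (suc k) → ℕ) where

    open Elimination M zero c pivot≉0

    reduced : Fin k → Fin s → ℕ
    reduced r j = eliminate (column M j) r

    obstruction-lift : Obstruction reduced (eliminate t) → Obstruction M t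
    obstruction-lift (l , l⊥M , l·t≉0) =
      lift l , (λ j → trans (≡⇒≈ (dot-lift l (column M j))) (l⊥M j)) , l·t≉0 ∘ trans (≡⇒≈ (sym (dot-lift l t)))

    solution-lift : Solution reduced (eliminate t) → Solution M t
    solution-lift (ψ′ , ψ′-solves) = ψ , solves
      where
      a S₀ μ : ℕ
      a = M zero c
      S₀ = dot s (M zero) ψ′
      μ = (t zero + neg S₀) * inv a pivot≉0

      δ : Fin s → Fin s → ℕ
      δ = kronecker Fin._≟_

      ψ : Fin s → ℕ
      ψ j = ψ′ j + δ j c * μ

      dot-ψ : ∀ R → dot s R ψ ≈ dot s R ψ′ + R c * μ
      dot-ψ R = begin
        dot s R ψ                                     ≡⟨ sumFin-cong s (λ j → *-distribˡ-+ (R j) _ _) ⟩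
        sumFin s (λ j → R j * ψ′ j + R j * (δ j c * μ)) ≡⟨ sumFin-+ s _ _ ⟩
        dot s R ψ′ + sumFin s (λ j → R j * (δ j c * μ)) ≈⟨ +-≈ˡ (dot s R ψ′) (sumFin-single s _ c off-c) ⟩
        dot s R ψ′ + R c * (δ c c * μ)                ≡⟨ cong (λ z → dot s R ψ′ + R c * z) at-c ⟩
        dot s R ψ′ + R c * μ                          ∎
        where
        open ≈-Reasoning
        off-c : ∀ j → j ≢ c → R j * (δ j c * μ) ≈ 0
        off-c j j≢c = ≡⇒≈ (trans (cong (λ z → R j * (z * μ)) (kronecker-≢ Fin._≟_ j≢c)) (*-zeroʳ (R j)))
        at-c : δ c c * μ ≡ μ
        at-c = trans (cong (_* μ) (kronecker-refl Fin._≟_ c)) (*-identityˡ μ)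

      solves-pivot : dot s (M zero) ψ ≈ t zero
      solves-pivot = begin
        dot s (M zero) ψ               ≈⟨ dot-ψ (M zero) ⟩
        S₀ + a * μ                     ≈⟨ +-≈ˡ S₀ aμ≈ ⟩
        S₀ + (t zero + neg S₀)         ≡⟨ +-comm S₀ _ ⟩
        t zero + neg S₀ + S₀           ≈⟨ +-neg-cancel (t zero) S₀ ⟩
        t zero                         ∎
        where
        open ≈-Reasoning
        a[bc]≡b[ac] : ∀ a b c → a * (b * c) ≡ b * (a * c)
        a[bc]≡b[ac] = solve-∀
        aμ≈ : a * μ ≈ t zero + neg S₀
        aμ≈ = trans (≡⇒≈ (a[bc]≡b[ac] a (t zero + neg S₀) (inv a pivot≉0)))
                (trans (*-≈ˡ (t zero + neg S₀) (*-inverseʳ a pivot≉0)) (≡⇒≈ (*-identityʳ _)))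

      solves-other : ∀ r → dot s (M (suc r)) ψ ≈ t (suc r)
      solves-other r = begin
        dot s (M (suc r)) ψ
          ≈⟨ sumFin-≈ s (λ j → *-≈ʳ (ψ j) (sym (eliminate-restore (column M j) r))) ⟩
        dot s (λ j → reduced r j + κ r * M zero j) ψ
          ≡⟨ dot-split ⟩
        dot s (reduced r) ψ + κ r * dot s (M zero) ψ
          ≈⟨ +-≈ (dot-ψ (reduced r)) (*-≈ˡ (κ r) solves-pivot) ⟩
        dot s (reduced r) ψ′ + reduced r c * μ + κ r * t zero
          ≈⟨ +-≈ (+-≈ (ψ′-solves r) (*-zeroˡ-≈ μ (eliminate-pivot r))) refl ⟩
        eliminate t r + 0 + κ r * t zero
          ≡⟨ cong (_+ κ r * t zero) (+-identityʳ _) ⟩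
        eliminate t r + κ r * t zero
          ≈⟨ eliminate-restore t r ⟩
        t (suc r) ∎
        where
        open ≈-Reasoning
        dot-split : dot s (λ j → reduced r j + κ r * M zero j) ψ ≡ dot s (reduced r) ψ + κ r * dot s (M zero) ψ
        dot-split = trans (sumFin-cong s (λ j → [u+kw]ψ≡uψ+k[wψ] (reduced r j) (κ r) (M zero j) (ψ j)))
          (trans (sumFin-+ s _ _) (cong (dot s (reduced r) ψ +_) (sym (sumFin-*ˡ s (κ r) _))))
          where [u+kw]ψ≡uψ+k[wψ] : ∀ u k w ψ → (u + k * w) * ψ ≡ u * ψ + k * (w * ψ)
                [u+kw]ψ≡uψ+k[wψ] = solve-∀

      solves : ∀ r → dot s (M r) ψ ≈ t r
      solves zero    = solves-pivot
      solves (suc r) = solves-other r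

  fredholm-alternative : ∀ k s (M : Fin k → Fin s → ℕ) (t : Fin k → ℕ) → Solution M t ⊎ Obstruction M t
  fredholm-alternative zero    s M t = inj₁ ((λ _ → 0) , λ ())
  fredholm-alternative (suc k) s M t with find-nonzero s (M zero)
  ... | inj₁ (c , pivot≉0) =
    Sum.map (solution-lift M c pivot≉0 t) (obstruction-lift M c pivot≉0 t)
      (fredholm-alternative k s (reduced M c pivot≉0 t) (Elimination.eliminate M zero c pivot≉0 t))
  ... | inj₂ M₀≈0 with t zero ≈? 0
  ...   | no t₀≉0 = inj₂ (e₀ , (λ j → trans (≡⇒≈ (e₀-dot (column M j))) (M₀≈0 j)) , t₀≉0 ∘ trans (≡⇒≈ (sym (e₀-dot t))))
    where
    e₀ : Fin (suc k) → ℕ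
    e₀ zero    = 1
    e₀ (suc _) = 0
    e₀-dot : ∀ v → dot (suc k) e₀ v ≡ v zero
    e₀-dot v = trans (cong₂ _+_ (*-identityˡ (v zero)) (sumFin-zero k (λ _ → refl))) (+-identityʳ (v zero))
  ...   | yes t₀≈0 = Sum.map extend-solution extend-obstruction (fredholm-alternative k s (M ∘ suc) (t ∘ suc))
    where
    extend-solution : Solution (M ∘ suc) (t ∘ suc) → Solution M t
    extend-solution (ψ , solves) = ψ , λ
      { zero    → trans (sumFin-≈0 s (λ j → *-zeroˡ-≈ (ψ j) (M₀≈0 j))) (sym t₀≈0)
      ; (suc r) → solves r }
    extend-obstruction : Obstruction (M ∘ suc) (t ∘ suc) → Obstruction M t
    extend-obstruction (l , l⊥M , l·t≉0) = (λ { zero → 0 ; (suc r) → l r }) , l⊥M , l·t≉0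

  Dependence : ∀ {k s} → (Fin k → Fin s → ℕ) → Set
  Dependence {k} {s} v = Σ (Fin k → ℕ) λ l → (Σ (Fin k) λ i → l i ≉ 0) × (∀ j → dot k l (column v j) ≈ 0)

  linearly-dependent : ∀ s k → s < k → (v : Fin k → Fin s → ℕ) → Dependence v
  linearly-dependent zero    (suc k) _         v = (λ _ → 1) , (zero , 1≉0) , λ ()
  linearly-dependent (suc s) (suc k) (s≤s s<k) v with find-nonzero (suc k) (column v zero)
  ... | inj₁ (i₀ , pivot≉0) = lift-dependence (linearly-dependent s k s<k remaining)
    where
    open Elimination v i₀ zero pivot≉0
    remaining : Fin k → Fin s → ℕ
    remaining r j = eliminate (column v (suc j)) r
    lift-dependence : Dependence remaining → Dependence v
    lift-dependence (μ , (i₁ , μ[i₁]≉0) , μ⊥remaining) =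
      lift μ , (punchIn i₀ i₁ , subst (_≉ 0) (sym (insertAt-punchIn μ i₀ _ i₁)) μ[i₁]≉0) , λ
        { zero    → lift-kills-pivot μ
        ; (suc j) → trans (≡⇒≈ (dot-lift μ (column v (suc j)))) (μ⊥remaining j) }
  ... | inj₂ v₀≈0 = extend (linearly-dependent s (suc k) (m<n⇒m<1+n s<k) (λ i j → v i (suc j)))
    where
    extend : Dependence (λ i j → v i (suc j)) → Dependence v
    extend (l , l≉0 , l⊥v) = l , l≉0 , λ
      { zero    → sumFin-≈0 (suc k) (λ i → *-zeroʳ-≈ (l i) (v₀≈0 i))
      ; (suc j) → l⊥v j }

module ReducedPolynomials (p : ℕ) (pr : Prime p) where

  open PrimeField p pr
  open LinearAlgebra p pr

  -- Coefficients are read modulo p; exponent vectors have entries below p (so binomialᵉ≉0 holds).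
  Exponent : ℕ → Set
  Exponent n = Vec (Fin p) n

  exponents : ∀ n → List (Exponent n)
  exponents n = allVecs p n

  _≟ᵉ_ : ∀ {n} → DecidableEquality (Exponent n)
  _≟ᵉ_ = ≡-dec Fin._≟_

  ∈-exponents : ∀ {n} (δ : Exponent n) → δ ∈ exponents n
  ∈-exponents []      = here refl
  ∈-exponents (t ∷ δ) = ∈-concatMap (λ w → map (_∷ w) (allFin p)) (∈-map⁺ (_∷ δ) (∈-allFin t)) (∈-exponents δ)

  exponents-unique : ∀ n → Unique (exponents n)
  exponents-unique zero    = [] ∷ []
  exponents-unique (suc n) = Unique-concatMap _ (exponents-unique n)
    (λ δ → Unique.map⁺ (proj₁ ∘ ∷-injective) (Unique.allFin⁺ p)) same-tail
    where
    same-tail : ∀ {δ δ′ α} → α ∈ map (_∷ δ) (allFin p) → α ∈ map (_∷ δ′) (allFin p) → δ ≡ δ′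
    same-tail α∈ α∈′ with ∈-map⁻ (_∷ _) α∈ | ∈-map⁻ (_∷ _) α∈′
    ... | _ , _ , refl | _ , _ , eq = proj₂ (∷-injective eq)

  sumMap-exponents-suc : ∀ n (f : Exponent (suc n) → ℕ) →
    sumMap (exponents (suc n)) f ≡ sumMap (exponents n) (λ δ → sumFin p (λ t → f (t ∷ δ)))
  sumMap-exponents-suc n f = trans (sumMap-concatMap _ (exponents n) f)
    (sumMap-cong (exponents n) (λ δ → trans (sumMap-map (_∷ δ) (allFin p) f) (sumMap-tabulate p (λ t → t) (λ t → f (t ∷ δ)))))

  sumMap-exponents-single : ∀ n (f : Exponent n → ℕ) δ → (∀ ε → ε ≢ δ → f ε ≈ 0) → sumMap (exponents n) f ≈ f δ
  sumMap-exponents-single n f δ = sumMap-single f (exponents-unique n) (∈-exponents δ)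

  Poly : ℕ → Set
  Poly n = Exponent n → ℕ

  monomial : ∀ {n} → Exponent n → Vec ℕ n → ℕ
  monomial []      []       = 1
  monomial (t ∷ δ) (u ∷ us) = u ^ toℕ t * monomial δ us

  toℕs : ∀ {n} → Pt p n → Vec ℕ n
  toℕs = Vec.map toℕ

  evalℕ : ∀ {n} → Poly n → Vec ℕ n → ℕ
  evalℕ {n} c u = sumMap (exponents n) (λ δ → c δ * monomial δ u)

  eval : ∀ {n} → Poly n → Pt p n → ℕ
  eval c x = evalℕ c (toℕs x)

  _∸ᶠ_ : Fin p → Fin p → Fin p
  a ∸ᶠ t = fromℕ< (≤-<-trans (m∸n≤m (toℕ a) (toℕ t)) (toℕ<n a))

  toℕ-∸ᶠ : ∀ a t → toℕ (a ∸ᶠ t) ≡ toℕ a ∸ toℕ t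
  toℕ-∸ᶠ a t = toℕ-fromℕ< _

  _∸ᵉ_ : ∀ {n} → Exponent n → Exponent n → Exponent n
  _∸ᵉ_ = zipWith _∸ᶠ_

  binomialᵉ : ∀ {n} → Exponent n → Exponent n → ℕ
  binomialᵉ []      []      = 1
  binomialᵉ (a ∷ α) (t ∷ δ) = (toℕ a C toℕ t) * binomialᵉ α δ

  _+ᵛ_ : ∀ {n} → Vec ℕ n → Vec ℕ n → Vec ℕ n
  _+ᵛ_ = zipWith _+_

  monomial-+ : ∀ {n} (α : Exponent n) u v →
    monomial α (u +ᵛ v) ≡ sumMap (exponents n) (λ δ → binomialᵉ α δ * monomial δ u * monomial (α ∸ᵉ δ) v)
  monomial-+ []      []       []       = refl
  monomial-+ {suc n} (a ∷ α) (u₀ ∷ u) (v₀ ∷ v) = begin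
    (u₀ + v₀) ^ toℕ a * monomial α (u +ᵛ v)
      ≡⟨ cong₂ _*_ (binomial-expansion p (toℕ<n a) u₀ v₀) (monomial-+ α u v) ⟩
    sumFin p B * sumMap (exponents n) Y
      ≡⟨ sumMap-*ˡ (exponents n) (sumFin p B) Y ⟩
    sumMap (exponents n) (λ δ → sumFin p B * Y δ)
      ≡⟨ sumMap-cong (exponents n) (λ δ → trans (sumFin-*ʳ p (Y δ) B) (sumFin-cong p (λ t → term t δ))) ⟩
    sumMap (exponents n) (λ δ → sumFin p (λ t → Z (t ∷ δ)))
      ≡⟨ sumMap-exponents-suc n Z ⟨
    sumMap (exponents (suc n)) Z ∎
    where
    open ≡-Reasoning
    B : Fin p → ℕ
    B t = binomialTerm (toℕ a) u₀ v₀ (toℕ t)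
    Y : Exponent n → ℕ
    Y δ = binomialᵉ α δ * monomial δ u * monomial (α ∸ᵉ δ) v
    Z : Exponent (suc n) → ℕ
    Z δ = binomialᵉ (a ∷ α) δ * monomial δ (u₀ ∷ u) * monomial ((a ∷ α) ∸ᵉ δ) (v₀ ∷ v)
    shuffle : ∀ c x y d m₁ m₂ → c * (x * y) * (d * m₁ * m₂) ≡ c * d * (x * m₁) * (y * m₂)
    shuffle = solve-∀
    term : ∀ t δ → B t * Y δ ≡ Z (t ∷ δ)
    term t δ rewrite toℕ-∸ᶠ a t =
      shuffle (toℕ a C toℕ t) (u₀ ^ toℕ t) (v₀ ^ (toℕ a ∸ toℕ t)) (binomialᵉ α δ) (monomial δ u) (monomial (α ∸ᵉ δ) v)

  monomial-addPt : ∀ {n} (δ : Exponent n) (x y : Pt p n) → monomial δ (toℕs (addPt pr x y)) ≈ monomial δ (toℕs x +ᵛ toℕs y)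
  monomial-addPt []      []       []       = refl
  monomial-addPt (t ∷ δ) (x₀ ∷ x) (y₀ ∷ y) =
    *-≈ (^-≈ (toℕ t) (trans (≡⇒≈ (toℕ-fromℕ< _)) (%-≈ (toℕ x₀ + toℕ y₀)))) (monomial-addPt δ x y)

  _≤ᵉ_ : ∀ {n} → Exponent n → Exponent n → Set
  _≤ᵉ_ = Pointwise Fin._≤_

  _≤ᵉ?_ : ∀ {n} (δ α : Exponent n) → Dec (δ ≤ᵉ α)
  _≤ᵉ?_ = Pointwise.decidable Fin._≤?_

  binomialᵉ-≰ : ∀ {n} (α δ : Exponent n) → ¬ δ ≤ᵉ α → binomialᵉ α δ ≡ 0
  binomialᵉ-≰ []      []      δ≰α = ⊥-elim (δ≰α [])
  binomialᵉ-≰ (a ∷ α) (t ∷ δ) δ≰α with toℕ t ≤? toℕ a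
  ... | no  t≰a = cong (_* binomialᵉ α δ) (k>n⇒nCk≡0 (≰⇒> t≰a))
  ... | yes t≤a = trans (cong ((toℕ a C toℕ t) *_) (binomialᵉ-≰ α δ (δ≰α ∘ (t≤a ∷_)))) (*-zeroʳ (toℕ a C toℕ t))

  binomialᵉ≉0 : ∀ {n} {δ α : Exponent n} → δ ≤ᵉ α → binomialᵉ α δ ≉ 0
  binomialᵉ≉0 []                         = 1≉0
  binomialᵉ≉0 {δ = t ∷ _} {a ∷ _} (t≤a ∷ δ≤α) = *-≉0 (nCk≉0 (toℕ<n a) t≤a) (binomialᵉ≉0 δ≤α)

  totalDeg-∸ᵉ : ∀ {n} {δ α : Exponent n} → δ ≤ᵉ α → totalDeg (α ∸ᵉ δ) + totalDeg δ ≡ totalDeg α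
  totalDeg-∸ᵉ []                                 = refl
  totalDeg-∸ᵉ {δ = t ∷ δ} {a ∷ α} (t≤a ∷ δ≤α) rewrite toℕ-∸ᶠ a t =
    trans (interchange (toℕ a ∸ toℕ t) (totalDeg (α ∸ᵉ δ)) (toℕ t) (totalDeg δ))
          (cong₂ _+_ (m∸n+n≡m t≤a) (totalDeg-∸ᵉ δ≤α))

  ∸ᵉ-cancelʳ : ∀ {n} {δ α α′ : Exponent n} → δ ≤ᵉ α → δ ≤ᵉ α′ → α ∸ᵉ δ ≡ α′ ∸ᵉ δ → α ≡ α′
  ∸ᵉ-cancelʳ []          []            _ = refl
  ∸ᵉ-cancelʳ {δ = t ∷ _} {a ∷ _} {a′ ∷ _} (t≤a ∷ δ≤α) (t≤a′ ∷ δ≤α′) eq with ∷-injective eq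
  ... | head-eq , tail-eq = cong₂ _∷_ (toℕ-injective (begin
    toℕ a                   ≡⟨ m∸n+n≡m t≤a ⟨
    toℕ a ∸ toℕ t + toℕ t   ≡⟨ cong (_+ toℕ t) (trans (sym (toℕ-∸ᶠ a t)) (trans (cong toℕ head-eq) (toℕ-∸ᶠ a′ t))) ⟩
    toℕ a′ ∸ toℕ t + toℕ t  ≡⟨ m∸n+n≡m t≤a′ ⟩
    toℕ a′                  ∎)) (∸ᵉ-cancelʳ δ≤α δ≤α′ tail-eq)
    where open ≡-Reasoning

  DegreeAtMost : ∀ {n} → ℕ → Poly n → Set
  DegreeAtMost d c = ∀ δ → d < totalDeg δ → c δ ≈ 0

  Nonzero : ∀ {n} → Poly n → Set
  Nonzero {n} c = Σ (Exponent n) λ δ → c δ ≉ 0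

  VanishesOn : ∀ {n} → Poly n → List (Pt p n) → Set
  VanishesOn c A = ∀ x → x ∈ A → eval c x ≈ 0

  Nondegenerate : ∀ {n} → List (Pt p n) → ℕ → Set
  Nondegenerate {n} A d = (c : Poly n) → DegreeAtMost d c → Nonzero c → ¬ VanishesOn c A

  degree-bound : ∀ {n d} {c : Poly n} → DegreeAtMost d c → ∀ δ → c δ ≉ 0 → totalDeg δ ≤ d
  degree-bound c-deg δ c[δ]≉0 = ≮⇒≥ (c[δ]≉0 ∘ c-deg δ)

  nondegenerate-anti : ∀ {n} (A : List (Pt p n)) {d d′} → d′ ≤ d → Nondegenerate A d → Nondegenerate A d′
  nondegenerate-anti A d′≤d A-nondeg c c-deg = A-nondeg c (λ δ d<δ → c-deg δ (≤-<-trans d′≤d d<δ))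

  exponents≤ : ∀ n → ℕ → List (Exponent n)
  exponents≤ n g = filter (λ δ → totalDeg δ ≤? g) (exponents n)

  exponents≤-totalDeg : ∀ n g r → totalDeg (lookup (exponents≤ n g) r) ≤ g
  exponents≤-totalDeg n g r = proj₂ (∈-filter⁻ (λ δ → totalDeg δ ≤? g) {xs = exponents n} (∈-lookup r))

  exponents≤-unique : ∀ n g → Unique (exponents≤ n g)
  exponents≤-unique n g = Unique.filter⁺ (λ δ → totalDeg δ ≤? g) (exponents-unique n)

  ∈-exponents≤ : ∀ {n g} (δ : Exponent n) → totalDeg δ ≤ g → δ ∈ exponents≤ n g
  ∈-exponents≤ δ δ≤g = ∈-filter⁺ (λ δ → totalDeg δ ≤? _) (∈-exponents δ) δ≤g

  combination : ∀ {n} (L : List (Exponent n)) → (Fin (length L) → ℕ) → Poly n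
  combination L l δ = dot (length L) l (λ r → kronecker _≟ᵉ_ (lookup L r) δ)

  combination-degree : ∀ {n} (L : List (Exponent n)) l g → (∀ r → totalDeg (lookup L r) ≤ g) →
    DegreeAtMost g (combination L l)
  combination-degree L l g L≤g δ g<δ = sumFin-≈0 (length L) (λ r → ≡⇒≈ (trans
    (cong (l r *_) (kronecker-≢ _≟ᵉ_ (λ L[r]≡δ → <⇒≱ g<δ (subst (λ ε → totalDeg ε ≤ g) L[r]≡δ (L≤g r)))))
    (*-zeroʳ (l r))))

  combination-lookup : ∀ {n} {L : List (Exponent n)} l → Unique L → ∀ r → combination L l (lookup L r) ≈ l r
  combination-lookup {L = L} l L-unique r = trans (sumFin-single (length L) _ r off-r) (≡⇒≈ at-r)
    where
    off-r : ∀ r′ → r′ ≢ r → l r′ * kronecker _≟ᵉ_ (lookup L r′) (lookup L r) ≈ 0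
    off-r r′ r′≢r = ≡⇒≈ (trans (cong (l r′ *_) (kronecker-≢ _≟ᵉ_ (r′≢r ∘ lookup-injective L-unique r′ r))) (*-zeroʳ (l r′)))
    at-r : l r * kronecker _≟ᵉ_ (lookup L r) (lookup L r) ≡ l r
    at-r = trans (cong (l r *_) (kronecker-refl _≟ᵉ_ (lookup L r))) (*-identityʳ (l r))

  eval-combination : ∀ {n} (L : List (Exponent n)) l u →
    evalℕ (combination L l) u ≈ dot (length L) l (λ r → monomial (lookup L r) u)
  eval-combination {n} L l u = begin
    sumMap (exponents n) (λ δ → dot k l (λ r → kronecker _≟ᵉ_ (lookup L r) δ) * monomial δ u)
      ≡⟨ sumMap-cong (exponents n) (λ δ → trans (sumFin-*ʳ k (monomial δ u) _) (sumFin-cong k (λ r → *-assoc (l r) _ _))) ⟩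
    sumMap (exponents n) (λ δ → sumFin k (λ r → l r * (kronecker _≟ᵉ_ (lookup L r) δ * monomial δ u)))
      ≡⟨ sumMap-sumFin (exponents n) k _ ⟩
    sumFin k (λ r → sumMap (exponents n) (λ δ → l r * (kronecker _≟ᵉ_ (lookup L r) δ * monomial δ u)))
      ≡⟨ sumFin-cong k (λ r → sym (sumMap-*ˡ (exponents n) (l r) _)) ⟩
    sumFin k (λ r → l r * sumMap (exponents n) (λ δ → kronecker _≟ᵉ_ (lookup L r) δ * monomial δ u))
      ≈⟨ sumFin-≈ k (λ r → *-≈ˡ (l r) (trans (sumMap-exponents-single n _ (lookup L r) (off r)) (≡⇒≈ (at r)))) ⟩
    dot k l (λ r → monomial (lookup L r) u) ∎
    where
    open ≈-Reasoning
    k : ℕ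
    k = length L
    off : ∀ r ε → ε ≢ lookup L r → kronecker _≟ᵉ_ (lookup L r) ε * monomial ε u ≈ 0
    off r ε ε≢L[r] = ≡⇒≈ (cong (_* monomial ε u) (kronecker-≢ _≟ᵉ_ (ε≢L[r] ∘ sym)))
    at : ∀ r → kronecker _≟ᵉ_ (lookup L r) (lookup L r) * monomial (lookup L r) u ≡ monomial (lookup L r) u
    at r = trans (cong (_* monomial (lookup L r) u) (kronecker-refl _≟ᵉ_ (lookup L r))) (*-identityˡ _)

  moment : ∀ {n} (B : List (Pt p n)) → (Fin (length B) → ℕ) → Exponent n → ℕ
  moment B ψ ε = dot (length B) (λ t → monomial ε (toℕs (lookup B t))) ψ

  -- By the Fredholm alternative: an obstruction would be a nonzero polynomial of degree ≤ totalDeg γ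
  -- vanishing on B.
  dual-functional : ∀ {n} (B : List (Pt p n)) b → Nondegenerate B b → (γ : Exponent n) → totalDeg γ ≤ b →
    Σ (Fin (length B) → ℕ) λ ψ → ∀ ε → totalDeg ε ≤ totalDeg γ → moment B ψ ε ≈ kronecker _≟ᵉ_ ε γ
  dual-functional {n} B b B-nondeg γ γ≤b with fredholm-alternative (length L) (length B) M (λ r → kronecker _≟ᵉ_ (lookup L r) γ)
    where
    L = exponents≤ n (totalDeg γ)
    M : Fin (length L) → Fin (length B) → ℕ
    M r t = monomial (lookup L r) (toℕs (lookup B t))
  ... | inj₁ (ψ , solves) = ψ , λ ε ε≤γ → at (∈-exponents≤ ε ε≤γ)
    where
    at : ∀ {ε} → ε ∈ exponents≤ n (totalDeg γ) → moment B ψ ε ≈ kronecker _≟ᵉ_ ε γ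
    at ε∈ = subst (λ ε → moment B ψ ε ≈ kronecker _≟ᵉ_ ε γ) (sym (lookup-index ε∈)) (solves (Any.index ε∈))
  ... | inj₂ (l , l⊥M , l·t≉0) =
    ⊥-elim (B-nondeg (combination L l) (λ δ b<δ → combination-degree L l _ (exponents≤-totalDeg n _) δ (≤-<-trans γ≤b b<δ))
                     (γ , l·t≉0) vanishes)
    where
    L = exponents≤ n (totalDeg γ)
    vanishes : VanishesOn (combination L l) B
    vanishes x x∈B = subst (λ x → eval (combination L l) x ≈ 0) (sym (lookup-index x∈B))
      (trans (eval-combination L l (toℕs (lookup B t))) (l⊥M t))
      where t : Fin (length B)
            t = Any.index x∈B

  shift : ∀ {n} → Poly n → Vec ℕ n → Poly n
  shift {n} c v δ = sumMap (exponents n) (λ α → c α * binomialᵉ α δ * monomial (α ∸ᵉ δ) v)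

  evalℕ-shift : ∀ {n} (c : Poly n) u v → evalℕ (shift c v) u ≡ evalℕ c (u +ᵛ v)
  evalℕ-shift {n} c u v = begin
    sumMap E (λ δ → sumMap E (λ α → c α * binomialᵉ α δ * monomial (α ∸ᵉ δ) v) * monomial δ u)
      ≡⟨ sumMap-cong E (λ δ → sumMap-*ʳ E (monomial δ u) _) ⟩
    sumMap E (λ δ → sumMap E (λ α → c α * binomialᵉ α δ * monomial (α ∸ᵉ δ) v * monomial δ u))
      ≡⟨ sumMap-swap E E _ ⟩
    sumMap E (λ α → sumMap E (λ δ → c α * binomialᵉ α δ * monomial (α ∸ᵉ δ) v * monomial δ u))
      ≡⟨ sumMap-cong E (λ α → trans (sumMap-cong E (λ δ → regroup (c α) _ _ _)) (sym (sumMap-*ˡ E (c α) _))) ⟩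
    sumMap E (λ α → c α * sumMap E (λ δ → binomialᵉ α δ * monomial δ u * monomial (α ∸ᵉ δ) v))
      ≡⟨ sumMap-cong E (λ α → cong (c α *_) (sym (monomial-+ α u v))) ⟩
    sumMap E (λ α → c α * monomial α (u +ᵛ v)) ∎
    where
    open ≡-Reasoning
    E : List (Exponent n)
    E = exponents n
    regroup : ∀ c b m m′ → c * b * m * m′ ≡ c * (b * m′ * m)
    regroup = solve-∀

  evalℕ-dot : ∀ {n} s (ψ : Fin s → ℕ) (Q : Fin s → Poly n) u →
    evalℕ (λ δ → dot s ψ (λ t → Q t δ)) u ≡ dot s ψ (λ t → evalℕ (Q t) u)
  evalℕ-dot {n} s ψ Q u = begin
    sumMap E (λ δ → dot s ψ (λ t → Q t δ) * monomial δ u)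
      ≡⟨ sumMap-cong E (λ δ → trans (sumFin-*ʳ s (monomial δ u) _) (sumFin-cong s (λ t → *-assoc (ψ t) _ _))) ⟩
    sumMap E (λ δ → sumFin s (λ t → ψ t * (Q t δ * monomial δ u)))
      ≡⟨ sumMap-sumFin E s _ ⟩
    sumFin s (λ t → sumMap E (λ δ → ψ t * (Q t δ * monomial δ u)))
      ≡⟨ sumFin-cong s (λ t → sym (sumMap-*ˡ E (ψ t) _)) ⟩
    dot s ψ (λ t → evalℕ (Q t) u) ∎
    where
    open ≡-Reasoning
    E : List (Exponent n)
    E = exponents n

  translateSum : ∀ {n} (B : List (Pt p n)) → (Fin (length B) → ℕ) → Poly n → Poly n
  translateSum B ψ c δ = dot (length B) ψ (λ t → shift c (toℕs (lookup B t)) δ)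

  eval-translateSum : ∀ {n} (B : List (Pt p n)) ψ c x →
    eval (translateSum B ψ c) x ≈ dot (length B) ψ (λ t → eval c (addPt pr x (lookup B t)))
  eval-translateSum {n} B ψ c x = trans (≡⇒≈ (evalℕ-dot s ψ _ (toℕs x)))
    (sumFin-≈ s (λ t → *-≈ˡ (ψ t) (trans (≡⇒≈ (evalℕ-shift c (toℕs x) (toℕs (lookup B t))))
      (sumMap-≈ (exponents n) (λ α _ → *-≈ˡ (c α) (sym (monomial-addPt α x (lookup B t))))))))
    where s : ℕ
          s = length B

  translateSum-moment : ∀ {n} (B : List (Pt p n)) ψ c δ →
    translateSum B ψ c δ ≡ sumMap (exponents n) (λ α → c α * binomialᵉ α δ * moment B ψ (α ∸ᵉ δ))
  translateSum-moment {n} B ψ c δ = begin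
    dot s ψ (λ t → sumMap E (λ α → c α * binomialᵉ α δ * monomial (α ∸ᵉ δ) (b t)))
      ≡⟨ sumFin-cong s (λ t → sumMap-*ˡ E (ψ t) _) ⟩
    sumFin s (λ t → sumMap E (λ α → ψ t * (c α * binomialᵉ α δ * monomial (α ∸ᵉ δ) (b t))))
      ≡⟨ sumMap-sumFin E s _ ⟨
    sumMap E (λ α → sumFin s (λ t → ψ t * (c α * binomialᵉ α δ * monomial (α ∸ᵉ δ) (b t))))
      ≡⟨ sumMap-cong E (λ α → trans (sumFin-cong s (λ t → regroup (ψ t) (c α * binomialᵉ α δ) (monomial (α ∸ᵉ δ) (b t))))
                                    (sym (sumFin-*ˡ s (c α * binomialᵉ α δ) _))) ⟩
    sumMap E (λ α → c α * binomialᵉ α δ * moment B ψ (α ∸ᵉ δ)) ∎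
    where
    open ≡-Reasoning
    E : List (Exponent n)
    E = exponents n
    s : ℕ
    s = length B
    b : Fin s → Vec ℕ n
    b t = toℕs (lookup B t)
    regroup : ∀ y k m → y * (k * m) ≡ k * (m * y)
    regroup = solve-∀

  leading : ∀ {n} (c : Poly n) → Nonzero c →
    Σ (Exponent n) λ α → c α ≉ 0 × (∀ α′ → c α′ ≉ 0 → totalDeg α′ ≤ totalDeg α)
  leading {n} c (δ₀ , c[δ₀]≉0) =
    α , argmax-all totalDeg c[δ₀]≉0 (all-filter nonzero? (exponents n)) , maximal
    where
    nonzero? : ∀ δ → Dec (c δ ≉ 0)
    nonzero? δ = ¬? (c δ ≈? 0)
    support : List (Exponent n)
    support = filter nonzero? (exponents n)
    α : Exponent n
    α = argmax totalDeg δ₀ support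
    maximal : ∀ α′ → c α′ ≉ 0 → totalDeg α′ ≤ totalDeg α
    maximal α′ c[α′]≉0 = All.lookup (f[xs]≤f[argmax] δ₀ support) (∈-filter⁺ nonzero? (∈-exponents α′) c[α′]≉0)

  0ᶠ : Fin p
  0ᶠ = fromℕ< (>-nonZero⁻¹ p)

  0ᵉ : ∀ n → Exponent n
  0ᵉ n = replicate n 0ᶠ

  totalDeg-0ᵉ : ∀ n → totalDeg (0ᵉ n) ≡ 0
  totalDeg-0ᵉ zero    = refl
  totalDeg-0ᵉ (suc n) = cong₂ _+_ (toℕ-fromℕ< _) (totalDeg-0ᵉ n)

  0ᵉ-≤ᵉ : ∀ {n} (α : Exponent n) → 0ᵉ n ≤ᵉ α
  0ᵉ-≤ᵉ []      = []
  0ᵉ-≤ᵉ (a ∷ α) = subst (_≤ toℕ a) (sym (toℕ-fromℕ< _)) z≤n ∷ 0ᵉ-≤ᵉ α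

  truncate : ∀ {n} → ℕ → Exponent n → Exponent n
  truncate a []      = []
  truncate a (x ∷ α) with toℕ x ≤? a
  ... | yes _   = x ∷ truncate (a ∸ toℕ x) α
  ... | no  x≰a = fromℕ< (<-trans (≰⇒> x≰a) (toℕ<n x)) ∷ 0ᵉ _

  truncate-≤ᵉ : ∀ {n} a (α : Exponent n) → truncate a α ≤ᵉ α
  truncate-≤ᵉ a []      = []
  truncate-≤ᵉ a (x ∷ α) with toℕ x ≤? a
  ... | yes _   = ≤-refl ∷ truncate-≤ᵉ (a ∸ toℕ x) α
  ... | no  x≰a = subst (_≤ toℕ x) (sym (toℕ-fromℕ< _)) (<⇒≤ (≰⇒> x≰a)) ∷ 0ᵉ-≤ᵉ α

  totalDeg-truncate : ∀ {n} a (α : Exponent n) → totalDeg (truncate a α) ≡ a ⊓ totalDeg α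
  totalDeg-truncate a []      = sym (⊓-zeroʳ a)
  totalDeg-truncate {suc n} a (x ∷ α) with toℕ x ≤? a
  ... | yes x≤a = begin
    toℕ x + totalDeg (truncate (a ∸ toℕ x) α) ≡⟨ cong (toℕ x +_) (totalDeg-truncate (a ∸ toℕ x) α) ⟩
    toℕ x + ((a ∸ toℕ x) ⊓ totalDeg α)       ≡⟨ +-distribˡ-⊓ (toℕ x) (a ∸ toℕ x) (totalDeg α) ⟩
    (toℕ x + (a ∸ toℕ x)) ⊓ (toℕ x + totalDeg α) ≡⟨ cong (_⊓ (toℕ x + totalDeg α)) (m+[n∸m]≡n x≤a) ⟩
    a ⊓ (toℕ x + totalDeg α)                 ∎
    where open ≡-Reasoning
  ... | no  x≰a = begin
    toℕ (fromℕ< _) + totalDeg (0ᵉ n) ≡⟨ cong₂ _+_ (toℕ-fromℕ< _) (totalDeg-0ᵉ n) ⟩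
    a + 0                            ≡⟨ +-identityʳ a ⟩
    a                                ≡⟨ m≤n⇒m⊓n≡m (≤-trans (<⇒≤ (≰⇒> x≰a)) (m≤m+n (toℕ x) (totalDeg α))) ⟨
    a ⊓ (toℕ x + totalDeg α)         ∎
    where open ≡-Reasoning

  _⊕_ : ∀ {n} → List (Pt p n) → List (Pt p n) → List (Pt p n)
  A ⊕ B = concatMap (λ x → map (addPt pr x) B) A

  ∈-⊕ : ∀ {n} {A B : List (Pt p n)} {x y} → x ∈ A → y ∈ B → addPt pr x y ∈ A ⊕ B
  ∈-⊕ {B = B} {x} x∈A y∈B = ∈-concatMap (λ x → map (addPt pr x) B) (∈-map⁺ (addPt pr x) y∈B) x∈A

  module SumsetStep {n} (B : List (Pt p n)) (a b : ℕ) (B-nondeg : Nondegenerate B b)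
                    (c : Poly n) (c-deg : DegreeAtMost (a + b) c)
                    (α : Exponent n) (c[α]≉0 : c α ≉ 0) (α-leading : ∀ α′ → c α′ ≉ 0 → totalDeg α′ ≤ totalDeg α) where

    α≤a+b : totalDeg α ≤ a + b
    α≤a+b = degree-bound c-deg α c[α]≉0

    β γ : Exponent n
    β = truncate a α
    γ = α ∸ᵉ β

    β≤a : totalDeg β ≤ a
    β≤a = subst (_≤ a) (sym (totalDeg-truncate a α)) (m⊓n≤m a (totalDeg α))

    γ+β≡α : totalDeg γ + totalDeg β ≡ totalDeg α
    γ+β≡α = totalDeg-∸ᵉ (truncate-≤ᵉ a α)

    γ≤b : totalDeg γ ≤ b
    γ≤b = subst (_≤ b) (sym γ≡α∸a) (m≤n+o⇒m∸n≤o (totalDeg α) a α≤a+b)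
      where
      γ≡α∸a : totalDeg γ ≡ totalDeg α ∸ a
      γ≡α∸a = begin
        totalDeg γ                                      ≡⟨ m+n∸n≡m (totalDeg γ) (totalDeg β) ⟨
        totalDeg γ + totalDeg β ∸ totalDeg β            ≡⟨ cong₂ _∸_ γ+β≡α (totalDeg-truncate a α) ⟩
        totalDeg α ∸ (a ⊓ totalDeg α)                   ≡⟨ ∸-distribˡ-⊓-⊔ (totalDeg α) a (totalDeg α) ⟩
        (totalDeg α ∸ a) ⊔ (totalDeg α ∸ totalDeg α)    ≡⟨ cong ((totalDeg α ∸ a) ⊔_) (n∸n≡0 (totalDeg α)) ⟩
        (totalDeg α ∸ a) ⊔ 0                            ≡⟨ ⊔-identityʳ (totalDeg α ∸ a) ⟩
        totalDeg α ∸ a                                  ∎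
        where open ≡-Reasoning

    ψ : Fin (length B) → ℕ
    ψ = proj₁ (dual-functional B b B-nondeg γ γ≤b)

    ψ-dual : ∀ ε → totalDeg ε ≤ totalDeg γ → moment B ψ ε ≈ kronecker _≟ᵉ_ ε γ
    ψ-dual = proj₂ (dual-functional B b B-nondeg γ γ≤b)

    moment-below : ∀ ε → totalDeg ε ≤ totalDeg γ → ε ≢ γ → moment B ψ ε ≈ 0
    moment-below ε ε≤γ ε≢γ = trans (ψ-dual ε ε≤γ) (≡⇒≈ (kronecker-≢ _≟ᵉ_ ε≢γ))

    P : Poly n
    P = translateSum B ψ c

    term-vanishes : ∀ α′ δ → (c α′ ≉ 0 → δ ≤ᵉ α′ → moment B ψ (α′ ∸ᵉ δ) ≈ 0) →
      c α′ * binomialᵉ α′ δ * moment B ψ (α′ ∸ᵉ δ) ≈ 0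
    term-vanishes α′ δ moment≈0 with c α′ ≈? 0 | δ ≤ᵉ? α′
    ... | yes c[α′]≈0 | _       = *-zeroˡ-≈ _ (*-zeroˡ-≈ (binomialᵉ α′ δ) c[α′]≈0)
    ... | no  _       | no  δ≰α′ = *-zeroˡ-≈ _ (*-zeroʳ-≈ (c α′) (≡⇒≈ (binomialᵉ-≰ α′ δ δ≰α′)))
    ... | no c[α′]≉0  | yes δ≤α′ = *-zeroʳ-≈ (c α′ * binomialᵉ α′ δ) (moment≈0 c[α′]≉0 δ≤α′)

    P-degree : DegreeAtMost a P
    P-degree δ a<δ = trans (≡⇒≈ (translateSum-moment B ψ c δ))
      (sumMap-≈0 (exponents n) λ α′ _ → term-vanishes α′ δ λ c[α′]≉0 δ≤α′ →
        let below = lower α′ c[α′]≉0 δ≤α′ in moment-below (α′ ∸ᵉ δ) (<⇒≤ below) (λ eq → <⇒≢ below (cong totalDeg eq)))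
      where
      lower : ∀ α′ → c α′ ≉ 0 → δ ≤ᵉ α′ → totalDeg (α′ ∸ᵉ δ) < totalDeg γ
      lower α′ c[α′]≉0 δ≤α′ = +-cancelʳ-< (totalDeg δ) (totalDeg (α′ ∸ᵉ δ)) (totalDeg γ) (begin-strict
        totalDeg (α′ ∸ᵉ δ) + totalDeg δ   ≡⟨ totalDeg-∸ᵉ δ≤α′ ⟩
        totalDeg α′                       ≤⟨ α-leading α′ c[α′]≉0 ⟩
        totalDeg α                        ≡⟨ γ+β≡α ⟨
        totalDeg γ + totalDeg β           ≤⟨ +-monoʳ-≤ (totalDeg γ) β≤a ⟩
        totalDeg γ + a                    <⟨ +-monoʳ-< (totalDeg γ) a<δ ⟩
        totalDeg γ + totalDeg δ           ∎)
        where open ≤-Reasoning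

    P-at-β : P β ≉ 0
    P-at-β P[β]≈0 = *-≉0 (*-≉0 c[α]≉0 (binomialᵉ≉0 (truncate-≤ᵉ a α))) 1≉0 (trans (sym P[β]≈) P[β]≈0)
      where
      others : ∀ α′ → α′ ≢ α → c α′ * binomialᵉ α′ β * moment B ψ (α′ ∸ᵉ β) ≈ 0
      others α′ α′≢α = term-vanishes α′ β λ c[α′]≉0 β≤α′ → moment-below (α′ ∸ᵉ β)
        (+-cancelʳ-≤ (totalDeg β) _ _ (≤-trans (≤-reflexive (totalDeg-∸ᵉ β≤α′))
          (≤-trans (α-leading α′ c[α′]≉0) (≤-reflexive (sym γ+β≡α)))))
        (α′≢α ∘ ∸ᵉ-cancelʳ β≤α′ (truncate-≤ᵉ a α))
      P[β]≈ : P β ≈ c α * binomialᵉ α β * 1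
      P[β]≈ = trans (≡⇒≈ (translateSum-moment B ψ c β))
        (trans (sumMap-exponents-single n _ α others)
          (*-≈ˡ (c α * binomialᵉ α β) (trans (ψ-dual γ ≤-refl) (≡⇒≈ (kronecker-refl _≟ᵉ_ γ)))))

  nondegenerate-⊕ : ∀ {n} (A B : List (Pt p n)) a b → Nondegenerate A a → Nondegenerate B b →
    Nondegenerate (A ⊕ B) (a + b)
  nondegenerate-⊕ A B a b A-nondeg B-nondeg c c-deg c-nonzero c-vanishes
    with leading c c-nonzero
  ... | α , c[α]≉0 , α-leading = A-nondeg P P-degree (β , P-at-β) P-vanishes
    where
    open SumsetStep B a b B-nondeg c c-deg α c[α]≉0 α-leading
    P-vanishes : VanishesOn P A
    P-vanishes x x∈A = trans (eval-translateSum B ψ c x)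
      (sumFin-≈0 (length B) (λ t → *-zeroʳ-≈ (ψ t) (c-vanishes _ (∈-⊕ x∈A (∈-lookup t)))))

  totalDeg≡0⇒0ᵉ : ∀ {n} (δ : Exponent n) → totalDeg δ ≡ 0 → δ ≡ 0ᵉ n
  totalDeg≡0⇒0ᵉ []      _  = refl
  totalDeg≡0⇒0ᵉ (t ∷ δ) eq = cong₂ _∷_
    (toℕ-injective (trans (m+n≡0⇒m≡0 (toℕ t) eq) (sym (toℕ-fromℕ< _))))
    (totalDeg≡0⇒0ᵉ δ (m+n≡0⇒n≡0 (toℕ t) eq))

  monomial-0ᵉ : ∀ {n} (u : Vec ℕ n) → monomial (0ᵉ n) u ≡ 1
  monomial-0ᵉ []               = refl
  monomial-0ᵉ {suc n} (u ∷ us) = cong₂ _*_ (cong (u ^_) (toℕ-fromℕ< (>-nonZero⁻¹ p))) (monomial-0ᵉ {n} us)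

  nondegenerate-zero : ∀ {n} → Nondegenerate (zeroPt {n = n} pr ∷ []) 0
  nondegenerate-zero {n} c c-deg (δ₀ , c[δ₀]≉0) c-vanishes =
    c[0ᵉ]≉0 (trans (sym eval≈c[0ᵉ]) (c-vanishes (zeroPt pr) (here refl)))
    where
    support : ∀ δ → c δ ≉ 0 → δ ≡ 0ᵉ n
    support δ c[δ]≉0 = totalDeg≡0⇒0ᵉ δ (n≤0⇒n≡0 (degree-bound c-deg δ c[δ]≉0))
    c[0ᵉ]≉0 : c (0ᵉ n) ≉ 0
    c[0ᵉ]≉0 = subst (λ δ → c δ ≉ 0) (support δ₀ c[δ₀]≉0) c[δ₀]≉0
    off-0ᵉ : ∀ δ → δ ≢ 0ᵉ n → c δ * monomial δ (toℕs (zeroPt {n = n} pr)) ≈ 0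
    off-0ᵉ δ δ≢0ᵉ with c δ ≈? 0
    ... | yes c[δ]≈0 = *-zeroˡ-≈ _ c[δ]≈0
    ... | no  c[δ]≉0 = ⊥-elim (δ≢0ᵉ (support δ c[δ]≉0))
    eval≈c[0ᵉ] : eval c (zeroPt pr) ≈ c (0ᵉ n)
    eval≈c[0ᵉ] = trans (sumMap-exponents-single n _ (0ᵉ n) off-0ᵉ)
      (≡⇒≈ (trans (cong (c (0ᵉ n) *_) (monomial-0ᵉ {n} (toℕs (zeroPt {n = n} pr)))) (*-identityʳ _)))

  nondegenerate-⊆ : ∀ {n} {A A′ : List (Pt p n)} {d} → (∀ {x} → x ∈ A → x ∈ A′) →
    Nondegenerate A d → Nondegenerate A′ d
  nondegenerate-⊆ A⊆A′ A-nondeg c c-deg c-nonzero c-vanishes =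
    A-nondeg c c-deg c-nonzero (λ x x∈A → c-vanishes x (A⊆A′ x∈A))

  -- Otherwise the N p n D monomials of degree ≤ D, as functions on S, would be linearly dependent.
  nondegenerate⇒N≤length : ∀ {n} (S : List (Pt p n)) D → Nondegenerate S D → N p n D ≤ length S
  nondegenerate⇒N≤length {n} S D S-nondeg with N p n D ≤? length S
  ... | yes N≤S = N≤S
  ... | no  N≰S with linearly-dependent (length S) (N p n D) (≰⇒> N≰S) (λ r t → monomial (lookup L r) (toℕs (lookup S t)))
    where L : List (Exponent n)
          L = exponents≤ n D
  ...   | l , (r₀ , l[r₀]≉0) , l⊥monomials = ⊥-elim (S-nondeg (combination L l)
            (combination-degree L l D (exponents≤-totalDeg n D))
            (lookup L r₀ , l[r₀]≉0 ∘ trans (sym (combination-lookup l (exponents≤-unique n D) r₀)))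
            vanishes)
    where
    L : List (Exponent n)
    L = exponents≤ n D
    vanishes : VanishesOn (combination L l) S
    vanishes x x∈S = subst (λ x → eval (combination L l) x ≈ 0) (sym (lookup-index x∈S))
      (trans (eval-combination L l (toℕs (lookup S t))) (l⊥monomials t))
      where t : Fin (length S)
            t = Any.index x∈S

  sumsetList : ∀ {n} m → (Fin m → List (Pt p n)) → List (Pt p n)
  sumsetList zero    A = zeroPt pr ∷ []
  sumsetList (suc m) A = A zero ⊕ sumsetList m (A ∘ suc)

  nondegenerate-sumsetList : ∀ {n} m (A : Fin m → List (Pt p n)) ns →
    (∀ i → Nondegenerate (A i) (ns i)) → Nondegenerate (sumsetList m A) (sumFin m ns)
  nondegenerate-sumsetList zero    A ns _          = nondegenerate-zero
  nondegenerate-sumsetList (suc m) A ns A-nondeg =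
    nondegenerate-⊕ (A zero) (sumsetList m (A ∘ suc)) (ns zero) (sumFin m (ns ∘ suc))
      (A-nondeg zero) (nondegenerate-sumsetList m (A ∘ suc) (ns ∘ suc) (A-nondeg ∘ suc))

  ∈-sumsetList⇒InSumset : ∀ {n} m (A : Fin m → List (Pt p n)) {x} → x ∈ sumsetList m A → InSumset pr A x
  ∈-sumsetList⇒InSumset zero    A (here refl) = (λ ()) , (λ ()) , refl
  ∈-sumsetList⇒InSumset (suc m) A x∈ with find (∈-concatMap⁻ _ {xs = A zero} x∈)
  ... | y , y∈A₀ , x∈y+rest with ∈-map⁻ (addPt pr y) x∈y+rest
  ...   | z , z∈rest , refl with ∈-sumsetList⇒InSumset m (A ∘ suc) z∈rest
  ...     | as , as∈A , refl = (λ { zero → y ; (suc i) → as i }) , (λ { zero → y∈A₀ ; (suc i) → as∈A i }) , refl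

  -- Coefficient functions on the exponent vectors listed by monos

  reduce : ∀ {n} → Vec ℕ n → Maybe (Exponent n)
  reduce []      = just []
  reduce (a ∷ α) with a <? p | reduce α
  ... | yes a<p | just δ  = just (fromℕ< a<p ∷ δ)
  ... | yes _   | nothing = nothing
  ... | no  _   | _       = nothing

  reduce-toℕs : ∀ {n} (δ : Exponent n) → reduce (toℕs δ) ≡ just δ
  reduce-toℕs []      = refl
  reduce-toℕs (t ∷ δ) with toℕ t <? p | reduce (toℕs δ) | reduce-toℕs δ
  ... | yes t<p | just _ | refl = cong (λ s → just (s ∷ δ)) (fromℕ<-toℕ t t<p)
  ... | no  t≮p | _      | _    = ⊥-elim (t≮p (toℕ<n t))

  reduce-≥ : ∀ {n} a (α : Vec ℕ n) → p ≤ a → reduce (a ∷ α) ≡ nothing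
  reduce-≥ a α p≤a with a <? p | reduce α
  ... | yes a<p | _ = ⊥-elim (<⇒≱ a<p p≤a)
  ... | no  _   | _ = refl

  reduce-tail : ∀ {n} a (α : Vec ℕ n) → reduce α ≡ nothing → reduce (a ∷ α) ≡ nothing
  reduce-tail a α eq with a <? p | reduce α
  ... | yes _ | nothing = refl
  ... | no  _ | _       = refl

  toℕs∈monos : ∀ {n d} (δ : Exponent n) → totalDeg δ ≤ d → toℕs δ ∈ monos n d
  toℕs∈monos []              _     = here refl
  toℕs∈monos {suc n} {d} (t ∷ δ) δ≤d =
    ∈-concatMap (λ a → map (a ∷_) (monos n (d ∸ a)))
      (∈-map⁺ (toℕ t ∷_) (toℕs∈monos δ (m+n≤o⇒m≤o∸n (totalDeg δ) (subst (_≤ d) (+-comm (toℕ t) (totalDeg δ)) δ≤d))))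
      (∈-upTo⁺ (s≤s (m+n≤o⇒m≤o (toℕ t) δ≤d)))

  sumMap-monos : ∀ n d (G : Vec ℕ n → ℕ) → (∀ α → reduce α ≡ nothing → G α ≡ 0) →
    sumMap (monos n d) G ≡ sumMap (exponents n) (λ δ → indicator (totalDeg δ ≤? d) * G (toℕs δ))
  sumMap-monos zero    d G _ = cong (_+ 0) (sym (*-identityˡ (G [])))
  sumMap-monos (suc n) d G G-reduced = begin
    sumMap (monos (suc n) d) G
      ≡⟨ sumMap-concatMap (λ a → map (a ∷_) (monos n (d ∸ a))) (upTo (suc d)) G ⟩
    sumMap (upTo (suc d)) (λ a → sumMap (map (a ∷_) (monos n (d ∸ a))) G)
      ≡⟨ sumMap-cong (upTo (suc d)) (λ a → trans (sumMap-map (a ∷_) (monos n (d ∸ a)) G)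
           (sumMap-monos n (d ∸ a) (G ∘ (a ∷_)) (λ α eq → G-reduced (a ∷ α) (reduce-tail a α eq)))) ⟩
    sumMap (upTo (suc d)) (λ a → sumMap (exponents n) (λ δ → indicator (totalDeg δ ≤? d ∸ a) * G (a ∷ toℕs δ)))
      ≡⟨ sumMap-swap (upTo (suc d)) (exponents n) _ ⟩
    sumMap (exponents n) (λ δ → sumMap (upTo (suc d)) (λ a → indicator (totalDeg δ ≤? d ∸ a) * G (a ∷ toℕs δ)))
      ≡⟨ sumMap-cong (exponents n) first-coordinate ⟩
    sumMap (exponents n) (λ δ → sumFin p (λ t → indicator (toℕ t + totalDeg δ ≤? d) * G (toℕ t ∷ toℕs δ)))
      ≡⟨ sumMap-exponents-suc n _ ⟨
    sumMap (exponents (suc n)) (λ δ → indicator (totalDeg δ ≤? d) * G (toℕs δ)) ∎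
    where
    open ≡-Reasoning
    first-coordinate : ∀ δ → sumMap (upTo (suc d)) (λ a → indicator (totalDeg δ ≤? d ∸ a) * G (a ∷ toℕs δ))
                 ≡ sumFin p (λ t → indicator (toℕ t + totalDeg δ ≤? d) * G (toℕ t ∷ toℕs δ))
    first-coordinate δ = begin
      sumMap (upTo (suc d)) (λ a → indicator (totalDeg δ ≤? d ∸ a) * G (a ∷ toℕs δ))
        ≡⟨ sumMap-applyUpTo (λ a → a) (suc d) _ ⟩
      sumFin (suc d) (λ i → indicator (totalDeg δ ≤? d ∸ toℕ i) * G (toℕ i ∷ toℕs δ))
        ≡⟨ sumFin-cong (suc d) (λ i → cong (_* G (toℕ i ∷ toℕs δ)) (same-indicator (toℕ i) (s≤s⁻¹ (toℕ<n i)))) ⟩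
      sumFin (suc d) (f ∘ toℕ)
        ≡⟨ sumFin-stable (suc d) p (λ a d<a → cong (_* G (a ∷ toℕs δ)) (indicator-no (a + totalDeg δ ≤? d)
             (λ a+δ≤d → <⇒≱ d<a (m+n≤o⇒m≤o a a+δ≤d))))
             (λ a p≤a → trans (cong (indicator (a + totalDeg δ ≤? d) *_) (G-reduced (a ∷ toℕs δ) (reduce-≥ a (toℕs δ) p≤a)))
                              (*-zeroʳ (indicator (a + totalDeg δ ≤? d)))) ⟩
      sumFin p (f ∘ toℕ) ∎
      where
      f : ℕ → ℕ
      f a = indicator (a + totalDeg δ ≤? d) * G (a ∷ toℕs δ)
      same-indicator : ∀ a → a ≤ d → indicator (totalDeg δ ≤? d ∸ a) ≡ indicator (a + totalDeg δ ≤? d)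
      same-indicator a a≤d = indicator-cong
        (λ δ≤d∸a → subst (_≤ d) (+-comm (totalDeg δ) a) (m≤o∸n⇒m+n≤o (totalDeg δ) a≤d δ≤d∸a))
        (λ a+δ≤d → m+n≤o⇒m≤o∸n (totalDeg δ) (subst (_≤ d) (+-comm a (totalDeg δ)) a+δ≤d))
        _ _

  toCoeffs : ∀ {n} → Poly n → Coeffs p n
  toCoeffs c α = maybe (λ δ → c δ mod p) 0ᶠ (reduce α)

  toCoeffs-toℕs : ∀ {n} (c : Poly n) δ → toℕ (toCoeffs c (toℕs δ)) ≡ c δ % p
  toCoeffs-toℕs c δ rewrite reduce-toℕs δ = toℕ-fromℕ< _

  toCoeffs-unreduced : ∀ {n} (c : Poly n) α → reduce α ≡ nothing → toℕ (toCoeffs c α) ≡ 0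
  toCoeffs-unreduced c α eq rewrite eq = toℕ-fromℕ< _

  monomialℕ-toℕs : ∀ {n} (x : Pt p n) (δ : Exponent n) → monomialℕ x (toℕs δ) ≡ monomial δ (toℕs x)
  monomialℕ-toℕs []       []      = refl
  monomialℕ-toℕs (x ∷ xs) (t ∷ δ) = cong (toℕ x ^ toℕ t *_) (monomialℕ-toℕs xs δ)

  hypothesis⇒nondegenerate : ∀ {n} (A : List (Pt p n)) d →
    ((c : Coeffs p n) → NonzeroPoly n d c → ¬ ((x : Pt p n) → x ∈ A → Vanishes pr d c x)) →
    Nondegenerate A d
  hypothesis⇒nondegenerate {n} A d hyp c c-deg (δ₀ , c[δ₀]≉0) c-vanishes = hyp (toCoeffs c) nonzero vanishes
    where
    nonzero : NonzeroPoly n d (toCoeffs c)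
    nonzero = toℕs δ₀ , toℕs∈monos δ₀ (degree-bound c-deg δ₀ c[δ₀]≉0) ,
      λ eq → c[δ₀]≉0 (trans (trans (sym (toCoeffs-toℕs c δ₀)) eq) (sym 0%p≡0))
    term : ∀ x δ → indicator (totalDeg δ ≤? d) * (toℕ (toCoeffs c (toℕs δ)) * monomialℕ x (toℕs δ)) ≈ c δ * monomial δ (toℕs x)
    term x δ with totalDeg δ ≤? d
    ... | no  δ≰d = sym (*-zeroˡ-≈ _ (c-deg δ (≰⇒> δ≰d)))
    ... | yes _   = trans (≡⇒≈ (trans (+-identityʳ _) (cong₂ _*_ (toCoeffs-toℕs c δ) (monomialℕ-toℕs x δ))))
                          (*-≈ʳ (monomial δ (toℕs x)) (%-≈ (c δ)))
    vanishes : (x : Pt p n) → x ∈ A → Vanishes pr d (toCoeffs c) x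
    vanishes x x∈A = trans (trans
      (≡⇒≈ (sumMap-monos n d (λ α → toℕ (toCoeffs c α) * monomialℕ x α)
             (λ α eq → cong (_* monomialℕ x α) (toCoeffs-unreduced c α eq))))
      (trans (sumMap-≈ (exponents n) (λ δ _ → term x δ)) (c-vanishes x x∈A))) 0%p≡0

theorem1p5 : (p n D m : ℕ) (pr : Prime p) → 1 ≤ n → 1 ≤ m →
    (ns : Fin m → ℕ) → ((i : Fin m) → 1 ≤ ns i) → sumFin m ns ≥ D →
    (A : Fin m → List (Pt p n)) →
    ((i : Fin m) → (c : Coeffs p n) → NonzeroPoly n (ns i) c →
      ¬ ((x : Pt p n) → x ∈ A i → Vanishes pr (ns i) c x)) →
    Σ (Fin (N p n D) → Pt p n) λ f →
      Injective _≡_ _≡_ f × ((k : Fin (N p n D)) → InSumset pr A (f k))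
theorem1p5 p n D m pr _ _ ns _ D≤Σns A hyp = f , f-injective , f-in-sumset
  where
  open ReducedPolynomials p pr
  S S′ : List (Pt p n)
  S = sumsetList m A
  S′ = deduplicate _≟ᵉ_ S
  S′-nondeg : Nondegenerate S′ D
  S′-nondeg = nondegenerate-⊆ (∈-deduplicate⁺ _≟ᵉ_) (nondegenerate-anti S D≤Σns
    (nondegenerate-sumsetList m A ns (λ i → hypothesis⇒nondegenerate (A i) (ns i) (hyp i))))
  N≤|S′| : N p n D ≤ length S′
  N≤|S′| = nondegenerate⇒N≤length S′ D S′-nondeg
  f : Fin (N p n D) → Pt p n
  f k = lookup S′ (inject≤ k N≤|S′|)
  f-injective : Injective _≡_ _≡_ f
  f-injective {k} {k′} eq = inject≤-injective N≤|S′| N≤|S′| k k′ (lookup-injective (deduplicate-! _≟ᵉ_ S) _ _ eq)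
  f-in-sumset : (k : Fin (N p n D)) → InSumset pr A (f k)
  f-in-sumset k = ∈-sumsetList⇒InSumset m A (∈-deduplicate⁻ _≟ᵉ_ S (∈-lookup (inject≤ k N≤|S′|)))
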